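{- Let $n\ge 4$ and write $n=2k+3+s$ with $k$ a nonnegative integer and $s\in\{0,1\}$. Let $c(u,v;\mathcal{L}_n)$ denote the number of shortest paths from $u$ to $v$ in the Alternate Lucas cube $\mathcal{L}_n$. Then $$c(0^s(10)^k100,\,1^s(01)^k001;\mathcal{L}_n)=c(0^s(10)^k100,\,1^s(01)^k010;\mathcal{L}_n)=E_{n-1},$$ $$c(0^s(10)^k001,\,1^s(01)^k010;\mathcal{L}_n)=c(0^s(10)^k010,\,1^s(01)^k001;\mathcal{L}_n)=\binom{n-1}{2}E_{n-3},$$ where $E_m$ denotes the $m$th Euler number.
   Context: For $n\ge1$, the hypercube $Q_n$ has vertex set $B_n=\{b_1\cdots b_n: b_i\in\{0,1\}\}$, two strings adjacent iff they differ in exactly one coordinate. For $n\ge3$, the Alternate Lucas cube $\mathcal{L}_n$ is the subgraph of $Q_n$ induced by the binary strings $b_1\cdots b_n$ with $b_ib_{i+1}=0$ for all $i\in\{1,\dots,n-1\}$ and additionally $b_{n-2}b_n=0$. $0^s$, $1^s$ denote $s$ repeated symbols and $(10)^k$ the string $10$ repeated $k$ times. A permutation $\sigma_1\cdots\sigma_m$ of $\{1,\dots,m\}$ is alternating if $\sigma_1>\sigma_2<\sigma_3>\sigma_4<\cdots$; the Euler number $E_m$ is the number of alternating permutations of $\{1,\dots,m\}$ (with $E_0=1$), so $E_1=1,E_2=1,E_3=2,E_4=5,E_5=16$; equivalently $\sum_{m\ge0}E_mx^m/m!=\sec x+\tan x$. -}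

module Defs where

open import Data.Bool using (Bool; true; false; _∧_; not; if_then_else_)
open import Data.Nat using (ℕ; zero; suc; _+_; _*_; _^_; _<ᵇ_)
open import Data.List using (List; []; _∷_; length; map; upTo; concat; replicate; reverse; concatMap; _++_; filter)
open import Data.List.Properties using (≡-dec)
open import Data.Nat.ListAction using (sum)
import Data.Bool.Properties as BP
open import Relation.Nullary.Decidable using (⌊_⌋)

-- Binary strings b₁⋯bₙ are lists of booleans (true = 1, false = 0).
BinStr : Set
BinStr = List Bool

noConsec11 : BinStr → Bool
noConsec11 (true ∷ true ∷ _) = false
noConsec11 (_ ∷ rest) = noConsec11 rest
noConsec11 [] = true

-- b_{n-2} b_n = 0 (read on the reversed string bₙ b_{n-1} b_{n-2} ⋯).
lastCond : BinStr → Bool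
lastCond b with reverse b
... | bn ∷ _ ∷ bn-2 ∷ _ = not (bn ∧ bn-2)
... | _ = true

inAltLucas : BinStr → Bool
inAltLucas b = noConsec11 b ∧ lastCond b

flipAt : ℕ → BinStr → BinStr
flipAt _ [] = []
flipAt zero (x ∷ xs) = not x ∷ xs
flipAt (suc i) (x ∷ xs) = x ∷ flipAt i xs

eqStr : BinStr → BinStr → Bool
eqStr u v = ⌊ ≡-dec BP._≟_ u v ⌋

walks : ℕ → BinStr → BinStr → ℕ
walks zero u v = if eqStr u v then 1 else 0
walks (suc m) u v =
  sum (map (λ i → if inAltLucas (flipAt i u) then walks m (flipAt i u) v else 0)
           (upTo (length u)))

firstWalkLen : BinStr → BinStr → ℕ → ℕ → ℕ
firstWalkLen u v start zero = start
firstWalkLen u v start (suc fuel) =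
  if 0 <ᵇ walks start u v then start else firstWalkLen u v (suc start) fuel

-- Distance d(u,v) in 𝓛_n: the least length of a walk from u to v
-- (searched up to 2^n, the number of vertices of Q_n, which bounds any distance).
dist : BinStr → BinStr → ℕ
dist u v = firstWalkLen u v 0 (2 ^ length u)

-- c(u,v;𝓛_n): number of shortest u–v paths = number of walks of length d(u,v)
-- (walks of minimum length are exactly the shortest paths).
numShortestPaths : BinStr → BinStr → ℕ
numShortestPaths u v = walks (dist u v) u v

-- Euler numbers: number of alternating permutations σ₁>σ₂<σ₃>⋯ of {1,…,m}.
insertEverywhere : ℕ → List ℕ → List (List ℕ)
insertEverywhere x [] = (x ∷ []) ∷ []
insertEverywhere x (y ∷ ys) = (x ∷ y ∷ ys) ∷ map (y ∷_) (insertEverywhere x ys)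

permutations : List ℕ → List (List ℕ)
permutations [] = [] ∷ []
permutations (x ∷ xs) = concatMap (insertEverywhere x) (permutations xs)

mutual
  altDown : List ℕ → Bool
  altDown (a ∷ b ∷ rest) = (b <ᵇ a) ∧ altUp (b ∷ rest)
  altDown _ = true

  altUp : List ℕ → Bool
  altUp (a ∷ b ∷ rest) = (a <ᵇ b) ∧ altDown (b ∷ rest)
  altUp _ = true

countTrue : List Bool → ℕ
countTrue [] = 0
countTrue (true ∷ xs) = suc (countTrue xs)
countTrue (false ∷ xs) = countTrue xs

oneTo : ℕ → List ℕ
oneTo m = map suc (upTo m)

Euler : ℕ → ℕ
Euler m = countTrue (map altDown (permutations (oneTo m)))

zeros ones : ℕ → BinStr
zeros s = replicate s false
ones s = replicate s true

p10 p01 : ℕ → BinStr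
p10 k = concat (replicate k (true ∷ false ∷ []))
p01 k = concat (replicate k (false ∷ true ∷ []))

b100 b001 b010 : BinStr
b100 = true ∷ false ∷ false ∷ []
b001 = false ∷ false ∷ true ∷ []
b010 = false ∷ true ∷ false ∷ []

{-# OPTIONS --safe #-}
-- A shortest path between vertices u, v of the Alternate Lucas cube flips every coordinate where they
-- differ exactly once.  If u and v share a 0 in coordinate n-2 or n, the condition b_{n-2} b_n = 0 never
-- binds along such a path, and avoiding 11 only decides, for two adjacent differing coordinates, which one
-- is flipped first.  So the shortest paths are the linear extensions of a zigzag poset on the differing
-- coordinates, counted by choosing the coordinate flipped first.  For the vertices of the theorem this
-- poset is an alternating chain on n-1 elements, whose linear extensions are the alternating permutations
-- counted by E_{n-1} (after reversing the chain when it starts with an ascent), or an alternating chain on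
-- n-3 elements beside a 2-element chain, giving the C(n-1,2) shuffles of the former with the latter.  The
-- pair 0^s(10)^k100, 1^s(01)^k001 has no such common 0, but swapping the last two coordinates is an
-- automorphism of the cube carrying it to 0^s(10)^k100, 1^s(01)^k010.

module Submission where

open import Defs
open import Data.Bool using (Bool; true; false; _∧_; not; if_then_else_; _xor_)
import Data.Bool.Properties as BP
open import Data.Maybe using (Maybe; just; nothing)
open import Data.Nat using (ℕ; zero; suc; _+_; _*_; _^_; _∸_; _<_; _≤_; _<ᵇ_; z≤n; s≤s; s≤s⁻¹; z<s; s<s)
open import Data.Nat.Properties
open import Data.Nat.Combinatorics using (_C_; nCn≡1; nCk+nC[k+1]≡[n+1]C[k+1])
open import Data.Nat.ListAction using (sum)
open import Data.Nat.ListAction.Properties using (sum-++; sum-↭)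
open import Data.Nat.Tactic.RingSolver using (solve-∀)
open import Algebra.Properties.CommutativeSemigroup +-commutativeSemigroup using (interchange)
open import Data.List using (List; []; _∷_; _++_; _∷ʳ_; map; length; concat; upTo; catMaybes; reverse)
open import Data.List.Properties
  using (map-++; map-∘; map-cong; map-cong-local; map-id; map-applyUpTo; ++-assoc; ++-identityʳ; length-++; length-++-≤ʳ;
         length-map; length-upTo; length-replicate; reverse-++; reverse-map; reverse-involutive; unfold-reverse;
         catMaybes-++; ≡-dec)
open import Data.List.Relation.Unary.All as All using (All; []; _∷_)
import Data.List.Relation.Unary.All.Properties as All
open import Data.List.Relation.Unary.AllPairs using (AllPairs; []; _∷_)
import Data.List.Relation.Unary.AllPairs.Properties as AllPairs
open import Data.List.Relation.Binary.Permutation.Propositional using (_↭_; ↭-refl; ↭-prep; ↭-swap; ↭-trans; ↭-sym)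
open import Data.List.Relation.Binary.Permutation.Propositional.Properties using (All-resp-↭; ↭-length; ↭-reverse)
open import Data.Product using (_×_; _,_; Σ-syntax; proj₁; proj₂)
open import Data.Sum using (_⊎_; inj₁; inj₂)
open import Function using (_∘_; id)
open import Relation.Nullary using (yes; no; contradiction)
open import Relation.Binary.PropositionalEquality

private
  variable
    A : Set

sum-map-+ : ∀ (f g : A → ℕ) xs → sum (map (λ x → f x + g x) xs) ≡ sum (map f xs) + sum (map g xs)
sum-map-+ f g []       = refl
sum-map-+ f g (x ∷ xs) = trans (cong (f x + g x +_) (sum-map-+ f g xs)) (interchange (f x) (g x) _ _)

sum-map-*ˡ : ∀ k (f : A → ℕ) xs → sum (map (λ x → k * f x) xs) ≡ k * sum (map f xs)
sum-map-*ˡ k f []       = sym (*-zeroʳ k)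
sum-map-*ˡ k f (x ∷ xs) = trans (cong (k * f x +_) (sum-map-*ˡ k f xs)) (sym (*-distribˡ-+ k (f x) _))

sum-map-++ : ∀ (f : A → ℕ) xs ys → sum (map f (xs ++ ys)) ≡ sum (map f xs) + sum (map f ys)
sum-map-++ f xs ys = trans (cong sum (map-++ f xs ys)) (sum-++ (map f xs) (map f ys))

sum-map-concat : ∀ (f : A → ℕ) xss → sum (map f (concat xss)) ≡ sum (map (sum ∘ map f) xss)
sum-map-concat f []         = refl
sum-map-concat f (xs ∷ xss) = trans (sum-map-++ f xs (concat xss)) (cong (sum (map f xs) +_) (sum-map-concat f xss))

sum-map-≡0 : ∀ {f : A → ℕ} → (∀ x → f x ≡ 0) → ∀ xs → sum (map f xs) ≡ 0
sum-map-≡0 f≡0 []       = refl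
sum-map-≡0 f≡0 (x ∷ xs) = cong₂ _+_ (f≡0 x) (sum-map-≡0 f≡0 xs)

sum-map-comm : ∀ {B : Set} (f : A → B → ℕ) xs ys →
  sum (map (λ x → sum (map (f x) ys)) xs) ≡ sum (map (λ y → sum (map (λ x → f x y) xs)) ys)
sum-map-comm f []       ys = sym (sum-map-≡0 (λ _ → refl) ys)
sum-map-comm f (x ∷ xs) ys = begin
  sum (map (f x) ys) + sum (map (λ x → sum (map (f x) ys)) xs)
    ≡⟨ cong (sum (map (f x) ys) +_) (sum-map-comm f xs ys) ⟩
  sum (map (f x) ys) + sum (map (λ y → sum (map (λ x → f x y) xs)) ys)
    ≡⟨ sym (sum-map-+ (f x) _ ys) ⟩
  sum (map (λ y → f x y + sum (map (λ x → f x y) xs)) ys) ∎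
  where open ≡-Reasoning

sum-map-positive : ∀ (f : A → ℕ) {xs} → All (λ x → 0 < f x) xs → 0 < length xs → 0 < sum (map f xs)
sum-map-positive f {x ∷ xs} (fx>0 ∷ _) _ = <-≤-trans fx>0 (m≤m+n (f x) _)

sum-upTo-suc : ∀ (f : ℕ → ℕ) n → sum (map f (upTo (suc n))) ≡ f 0 + sum (map (f ∘ suc) (upTo n))
sum-upTo-suc f n = cong (λ xs → f 0 + sum xs) (trans (map-applyUpTo suc f n) (sym (map-applyUpTo id (f ∘ suc) n)))

-- Zigzag patterns and their linear extensions

-- Step i of a pattern compares positions i-1 and i of an ordering σ: down means σ(i-1) > σ(i) and up
-- means σ(i-1) < σ(i); step 0 compares with nothing and is free.
data Step : Set where
  free down up : Step

notUp : Step → Bool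
notUp up = false
notUp _  = true

notDown : Step → Bool
notDown down = false
notDown _    = true

headNotDown : List Step → Bool
headNotDown []      = true
headNotDown (s ∷ _) = notDown s

freeHead : List Step → List Step
freeHead []       = []
freeHead (_ ∷ ss) = free ∷ ss

removeHead : Step → List Step → List (List Step)
removeHead s ss = if notUp s ∧ headNotDown ss then freeHead ss ∷ [] else []

removals : List Step → List (List Step)
removals []       = []
removals (s ∷ ss) = removeHead s ss ++ map (s ∷_) (removals ss)

-- The orderings obeying p, counted by the position placed first; the fuel m is always length p.
extensions : ℕ → List Step → ℕ
extensions zero    _ = 1
extensions (suc m) p = sum (map (extensions m) (removals p))

data StartsFree : List Step → Set where
  []    : StartsFree []
  free∷ : ∀ ss → StartsFree (free ∷ ss)

removals-startsFree : ∀ {p} → StartsFree p → All StartsFree (removals p)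
removals-startsFree []         = []
removals-startsFree (free∷ ss) = All.++⁺ (head-free ss) (All.map⁺ (All.universal (λ r → free∷ r) (removals ss)))
  where
  head-free : ∀ ss → All StartsFree (removeHead free ss)
  head-free []           = [] ∷ []
  head-free (s ∷ ss) with notDown s
  ... | true  = free∷ ss ∷ []
  ... | false = []

removals-length : ∀ p → All (λ r → suc (length r) ≡ length p) (removals p)
removals-length []       = []
removals-length (s ∷ ss) = All.++⁺ (head-length ss) (All.map⁺ (All.map (cong suc) (removals-length ss)))
  where
  head-length : ∀ ss → All (λ r → suc (length r) ≡ suc (length ss)) (removeHead s ss)
  head-length []       with notUp s
  ... | true  = refl ∷ []
  ... | false = []
  head-length (t ∷ ss) with notUp s ∧ notDown t
  ... | true  = refl ∷ []
  ... | false = []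

removals-nonEmpty : ∀ s ss → notUp s ≡ true → 0 < length (removals (s ∷ ss))
removals-∷down-nonEmpty : ∀ s ss → 0 < length (removals (s ∷ down ∷ ss))

removals-nonEmpty up   _           ()
removals-nonEmpty free (down ∷ ss) _ = removals-∷down-nonEmpty free ss
removals-nonEmpty down (down ∷ ss) _ = removals-∷down-nonEmpty down ss
removals-nonEmpty free []          _ = z<s
removals-nonEmpty free (free ∷ _)  _ = z<s
removals-nonEmpty free (up ∷ _)    _ = z<s
removals-nonEmpty down []          _ = z<s
removals-nonEmpty down (free ∷ _)  _ = z<s
removals-nonEmpty down (up ∷ _)    _ = z<s

removals-∷down-nonEmpty s ss = begin-strict
  0                                          <⟨ removals-nonEmpty down ss refl ⟩
  length (removals (down ∷ ss))              ≡⟨ length-map (s ∷_) (removals (down ∷ ss)) ⟨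
  length (map (s ∷_) (removals (down ∷ ss))) ≤⟨ m≤n+m _ (length (removeHead s (down ∷ ss))) ⟩
  length (removeHead s (down ∷ ss)) + length (map (s ∷_) (removals (down ∷ ss)))
                                             ≡⟨ length-++ (removeHead s (down ∷ ss)) ⟨
  length (removals (s ∷ down ∷ ss))          ∎
  where open ≤-Reasoning

extensions-positive : ∀ d {p} → StartsFree p → length p ≡ d → 0 < extensions d p
extensions-positive zero    _           _  = z<s
extensions-positive (suc d) (free∷ ss) eq =
  sum-map-positive (extensions d)
    (All.map (λ (r-free , r-length) → extensions-positive d r-free (suc-injective (trans r-length eq)))
      (All.zip (removals-startsFree (free∷ ss) , removals-length (free ∷ ss))))
    (removals-nonEmpty free ss refl)

removeHead-++ : ∀ s p {q} → StartsFree q → removeHead s (p ++ q) ≡ map (_++ q) (removeHead s p)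
removeHead-++ s []      []         with notUp s
... | true  = refl
... | false = refl
removeHead-++ s []      (free∷ _)  with notUp s
... | true  = refl
... | false = refl
removeHead-++ s (t ∷ _) _          with notUp s ∧ notDown t
... | true  = refl
... | false = refl

removals-++ : ∀ p {q} → StartsFree q →
  removals (p ++ q) ≡ map (_++ q) (removals p) ++ map (p ++_) (removals q)
removals-++ []      {q} _      = sym (map-id (removals q))
removals-++ (s ∷ p) {q} q-free = begin
  removeHead s (p ++ q) ++ map (s ∷_) (removals (p ++ q))
    ≡⟨ cong₂ _++_ (removeHead-++ s p q-free) (cong (map (s ∷_)) (removals-++ p q-free)) ⟩
  map (_++ q) (removeHead s p) ++ map (s ∷_) (map (_++ q) (removals p) ++ map (p ++_) (removals q))
    ≡⟨ cong (map (_++ q) (removeHead s p) ++_) (map-++ (s ∷_) (map (_++ q) (removals p)) _) ⟩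
  map (_++ q) (removeHead s p) ++ (map (s ∷_) (map (_++ q) (removals p)) ++ map (s ∷_) (map (p ++_) (removals q)))
    ≡⟨ cong₂ (λ xs ys → map (_++ q) (removeHead s p) ++ (xs ++ ys))
         (trans (sym (map-∘ (removals p))) (map-∘ (removals p))) (sym (map-∘ (removals q))) ⟩
  map (_++ q) (removeHead s p) ++ (map (_++ q) (map (s ∷_) (removals p)) ++ map ((s ∷ p) ++_) (removals q))
    ≡⟨ ++-assoc (map (_++ q) (removeHead s p)) _ _ ⟨
  (map (_++ q) (removeHead s p) ++ map (_++ q) (map (s ∷_) (removals p))) ++ map ((s ∷ p) ++_) (removals q)
    ≡⟨ cong (_++ map ((s ∷ p) ++_) (removals q)) (map-++ (_++ q) (removeHead s p) _) ⟨
  map (_++ q) (removals (s ∷ p)) ++ map ((s ∷ p) ++_) (removals q) ∎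
  where open ≡-Reasoning

sum-removals-++ : ∀ (F : List Step → ℕ) p {q} → StartsFree q →
  sum (map F (removals (p ++ q))) ≡ sum (map (λ r → F (r ++ q)) (removals p)) + sum (map (λ r → F (p ++ r)) (removals q))
sum-removals-++ F p {q} q-free = begin
  sum (map F (removals (p ++ q)))
    ≡⟨ cong (sum ∘ map F) (removals-++ p q-free) ⟩
  sum (map F (map (_++ q) (removals p) ++ map (p ++_) (removals q)))
    ≡⟨ sum-map-++ F (map (_++ q) (removals p)) _ ⟩
  sum (map F (map (_++ q) (removals p))) + sum (map F (map (p ++_) (removals q)))
    ≡⟨ cong₂ _+_ (cong sum (sym (map-∘ (removals p)))) (cong sum (sym (map-∘ (removals q)))) ⟩
  sum (map (λ r → F (r ++ q)) (removals p)) + sum (map (λ r → F (p ++ r)) (removals q)) ∎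
  where open ≡-Reasoning

-- The orderings of a disjoint union of two zigzag posets are the shuffles of orderings of each.
extensions-++ : ∀ N {a b p q} → length p ≡ a → length q ≡ b → a + b ≡ N → StartsFree q →
  extensions N (p ++ q) ≡ (N C b) * (extensions a p * extensions b q)
extensions-++ N {zero} {b} {[]} {q} _ refl refl _ rewrite nCn≡1 b = sym (trans (*-identityˡ _) (*-identityˡ _))
extensions-++ N {a} {zero} {p} {[]} _ _ refl _ =
  trans (cong₂ extensions (+-identityʳ a) (++-identityʳ p)) (sym (trans (*-identityˡ _) (*-identityʳ _)))
extensions-++ (suc N) {suc a} {suc b} {p} {q} p-length q-length a+b≡N q-free = begin
  sum (map (extensions N) (removals (p ++ q)))
    ≡⟨ sum-removals-++ (extensions N) p q-free ⟩
  sum (map (λ r → extensions N (r ++ q)) (removals p)) + sum (map (λ r → extensions N (p ++ r)) (removals q))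
    ≡⟨ cong₂ _+_ (cong sum (map-cong-local (All.map left (removals-length p))))
                 (cong sum (map-cong-local (All.map right (All.zip (removals-startsFree q-free , removals-length q))))) ⟩
  sum (map (λ r → ((N C suc b) * Y) * extensions a r) (removals p))
    + sum (map (λ r → ((N C b) * X) * extensions b r) (removals q))
    ≡⟨ cong₂ _+_ (sum-map-*ˡ ((N C suc b) * Y) (extensions a) (removals p))
                 (sum-map-*ˡ ((N C b) * X) (extensions b) (removals q)) ⟩
  ((N C suc b) * Y) * X + ((N C b) * X) * Y
    ≡⟨ regroup (N C suc b) (N C b) X Y ⟩
  ((N C b) + (N C suc b)) * (X * Y)
    ≡⟨ cong (_* (X * Y)) (nCk+nC[k+1]≡[n+1]C[k+1] N b) ⟩
  (suc N C suc b) * (X * Y) ∎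
  where
  open ≡-Reasoning
  X Y : ℕ
  X = extensions (suc a) p
  Y = extensions (suc b) q
  regroup : ∀ k l x y → (k * y) * x + (l * x) * y ≡ (l + k) * (x * y)
  regroup = solve-∀
  left : ∀ {r} → suc (length r) ≡ length p → extensions N (r ++ q) ≡ ((N C suc b) * Y) * extensions a r
  left {r} r-length =
    trans (extensions-++ N (suc-injective (trans r-length p-length)) q-length (suc-injective a+b≡N) q-free)
          (regroup′ (N C suc b) (extensions a r) Y)
    where
    regroup′ : ∀ k e y → k * (e * y) ≡ (k * y) * e
    regroup′ = solve-∀
  right : ∀ {r} → StartsFree r × suc (length r) ≡ length q → extensions N (p ++ r) ≡ ((N C b) * X) * extensions b r
  right {r} (r-free , r-length) =
    trans (extensions-++ N p-length (suc-injective (trans r-length q-length)) (trans (sym (+-suc a b)) (suc-injective a+b≡N)) r-free)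
          (sym (*-assoc (N C b) X _))

-- Alternating permutations

mirror : Step → Step
mirror free = free
mirror down = up
mirror up   = down

zigzag : Step → ℕ → List Step
zigzag _ zero    = []
zigzag s (suc m) = s ∷ zigzag (mirror s) m

alternating : ℕ → List Step
alternating zero    = []
alternating (suc m) = free ∷ zigzag down m

length-zigzag : ∀ s m → length (zigzag s m) ≡ m
length-zigzag s zero    = refl
length-zigzag s (suc m) = cong suc (length-zigzag (mirror s) m)

length-alternating : ∀ m → length (alternating m) ≡ m
length-alternating zero    = refl
length-alternating (suc m) = cong suc (length-zigzag down m)

holds : Step → ℕ → ℕ → Bool
holds free _ _ = true
holds down a b = b <ᵇ a
holds up   a b = a <ᵇ b

fits : ℕ → List Step → List ℕ → Bool
fits _ []       []       = true
fits a (s ∷ ss) (b ∷ bs) = holds s a b ∧ fits b ss bs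
fits _ _        _        = false

ind : Bool → ℕ
ind b = if b then 1 else 0

ind-∧ : ∀ a b → ind (a ∧ b) ≡ ind a * ind b
ind-∧ true  b = sym (*-identityˡ (ind b))
ind-∧ false b = refl

sum-map-ind-∧ : ∀ {A : Set} b (f : A → Bool) xs → sum (map (λ x → ind (b ∧ f x)) xs) ≡ ind b * sum (map (ind ∘ f) xs)
sum-map-ind-∧ b f xs = trans (cong sum (map-cong (λ x → ind-∧ b (f x)) xs)) (sum-map-*ˡ (ind b) (ind ∘ f) xs)

countTrue-map : ∀ {A : Set} (f : A → Bool) xs → countTrue (map f xs) ≡ sum (map (ind ∘ f) xs)
countTrue-map f []       = refl
countTrue-map f (x ∷ xs) with f x
... | true  = cong suc (countTrue-map f xs)
... | false = countTrue-map f xs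

<ᵇ-true : ∀ {m n} → m < n → (m <ᵇ n) ≡ true
<ᵇ-true {m} {n} m<n with m <ᵇ n | <⇒<ᵇ m<n
... | true | _ = refl

<ᵇ-false : ∀ {m n} → n ≤ m → (m <ᵇ n) ≡ false
<ᵇ-false {m} {n} n≤m with m <ᵇ n | <ᵇ⇒< m n
... | false | _ = refl
... | true  | m<n = contradiction (m<n _) (≤⇒≯ n≤m)

holds-below : ∀ s {a x} → x < a → holds s a x ≡ notUp s
holds-below free x<a = refl
holds-below down x<a = <ᵇ-true x<a
holds-below up   x<a = <ᵇ-false (<⇒≤ x<a)

holds-above : ∀ s {x b} → x < b → holds s x b ≡ notDown s
holds-above free x<b = refl
holds-above down x<b = <ᵇ-false (<⇒≤ x<b)
holds-above up   x<b = <ᵇ-true x<b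

fits-free : ∀ a c ss bs → fits a (free ∷ ss) bs ≡ fits c (free ∷ ss) bs
fits-free a c ss []       = refl
fits-free a c ss (_ ∷ _)  = refl

-- Inserting a new least value x into q amounts to choosing the position of x among the removable ones.
insertEverywhere-fits : ∀ {x a} q p → x < a → All (x <_) q → length p ≡ suc (length q) →
  sum (map (ind ∘ fits a p) (insertEverywhere x q)) ≡ sum (map (λ r → ind (fits a r q)) (removals p))
insertEverywhere-fits {x} {a} [] (s ∷ []) x<a [] _ rewrite holds-below s x<a with notUp s
... | true  = refl
... | false = refl
insertEverywhere-fits {x} {a} (y ∷ ys) (s ∷ t ∷ ss) x<a (x<y ∷ x<ys) length≡ = begin
  ind (holds s a x ∧ (holds t x y ∧ fits y ss ys)) + sum (map (ind ∘ fits a (s ∷ t ∷ ss)) (map (y ∷_) W))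
    ≡⟨ cong₂ _+_ first (cong sum (sym (map-∘ W))) ⟩
  H + sum (map (λ w → ind (h ∧ fits y (t ∷ ss) w)) W)
    ≡⟨ cong (H +_) (sum-map-ind-∧ h (fits y (t ∷ ss)) W) ⟩
  H + ind h * sum (map (ind ∘ fits y (t ∷ ss)) W)
    ≡⟨ cong (λ n → H + ind h * n) (insertEverywhere-fits ys (t ∷ ss) x<y x<ys (suc-injective length≡)) ⟩
  H + ind h * sum (map (λ r → ind (fits y r ys)) (removals (t ∷ ss)))
    ≡⟨ cong (H +_) (sum-map-ind-∧ h (λ r → fits y r ys) (removals (t ∷ ss))) ⟨
  H + sum (map (λ r → ind (h ∧ fits y r ys)) (removals (t ∷ ss)))
    ≡⟨ cong (H +_) (cong sum (map-∘ (removals (t ∷ ss)))) ⟩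
  H + sum (map G (map (s ∷_) (removals (t ∷ ss))))
    ≡⟨ sum-map-++ G (removeHead s (t ∷ ss)) _ ⟨
  sum (map G (removals (s ∷ t ∷ ss))) ∎
  where
  open ≡-Reasoning
  W : List (List ℕ)
  W = insertEverywhere x ys
  G : List Step → ℕ
  G r = ind (fits a r (y ∷ ys))
  H : ℕ
  H = sum (map G (removeHead s (t ∷ ss)))
  h : Bool
  h = holds s a y
  first : ind (holds s a x ∧ (holds t x y ∧ fits y ss ys)) ≡ H
  first rewrite holds-below s x<a | holds-above t x<y | sym (BP.∧-assoc (notUp s) (notDown t) (fits y ss ys))
    with notUp s ∧ notDown t
  ... | true  = sym (+-identityʳ _)
  ... | false = refl

insertEverywhere-↭ : ∀ x q → All (_↭ x ∷ q) (insertEverywhere x q)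
insertEverywhere-↭ x []       = ↭-refl ∷ []
insertEverywhere-↭ x (y ∷ ys) =
  ↭-refl ∷ All.map⁺ (All.map (λ w↭ → ↭-trans (↭-prep y w↭) (↭-swap y x ↭-refl)) (insertEverywhere-↭ x ys))

permutations-↭ : ∀ xs → All (_↭ xs) (permutations xs)
permutations-↭ []       = ↭-refl ∷ []
permutations-↭ (x ∷ xs) =
  All.concat⁺ (All.map⁺ (All.map (λ q↭ → All.map (λ w↭ → ↭-trans w↭ (↭-prep x q↭)) (insertEverywhere-↭ x _))
                                 (permutations-↭ xs)))

permutations-fits : ∀ {xs} → AllPairs _<_ xs → ∀ {p} → StartsFree p → length p ≡ length xs → ∀ a →
  sum (map (ind ∘ fits a p) (permutations xs)) ≡ extensions (length xs) p
permutations-fits [] [] _ _ = refl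
permutations-fits {x ∷ ys} (x<ys ∷ ys-increasing) {p} (free∷ ss) length≡ a = begin
  sum (map (ind ∘ fits a p) (concat (map (insertEverywhere x) (permutations ys))))
    ≡⟨ sum-map-concat (ind ∘ fits a p) (map (insertEverywhere x) (permutations ys)) ⟩
  sum (map (sum ∘ map (ind ∘ fits a p)) (map (insertEverywhere x) (permutations ys)))
    ≡⟨ cong sum (map-∘ (permutations ys)) ⟨
  sum (map (λ q → sum (map (ind ∘ fits a p) (insertEverywhere x q))) (permutations ys))
    ≡⟨ cong sum (map-cong-local (All.map insert (permutations-↭ ys))) ⟩
  sum (map (λ q → sum (map (λ r → ind (fits (suc x) r q)) (removals p))) (permutations ys))
    ≡⟨ sum-map-comm (λ q r → ind (fits (suc x) r q)) (permutations ys) (removals p) ⟩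
  sum (map (λ r → sum (map (ind ∘ fits (suc x) r) (permutations ys))) (removals p))
    ≡⟨ cong sum (map-cong-local (All.map count (All.zip (removals-startsFree (free∷ ss) , removals-length p)))) ⟩
  sum (map (extensions (length ys)) (removals p)) ∎
  where
  open ≡-Reasoning
  insert : ∀ {q} → q ↭ ys →
    sum (map (ind ∘ fits a p) (insertEverywhere x q)) ≡ sum (map (λ r → ind (fits (suc x) r q)) (removals p))
  insert {q} q↭ = trans (cong sum (map-cong (λ w → cong ind (fits-free a (suc x) ss w)) (insertEverywhere x q)))
    (insertEverywhere-fits q p ≤-refl (All-resp-↭ (↭-sym q↭) x<ys) (trans length≡ (cong suc (sym (↭-length q↭)))))
  count : ∀ {r} → StartsFree r × suc (length r) ≡ length p →
    sum (map (ind ∘ fits (suc x) r) (permutations ys)) ≡ extensions (length ys) r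
  count (r-free , r-length) = permutations-fits ys-increasing r-free (suc-injective (trans r-length length≡)) (suc x)

mutual
  altDown-fits : ∀ a l → altDown (a ∷ l) ≡ fits a (zigzag down (length l)) l
  altDown-fits a []      = refl
  altDown-fits a (b ∷ l) = cong ((b <ᵇ a) ∧_) (altUp-fits b l)

  altUp-fits : ∀ a l → altUp (a ∷ l) ≡ fits a (zigzag up (length l)) l
  altUp-fits a []      = refl
  altUp-fits a (b ∷ l) = cong ((a <ᵇ b) ∧_) (altDown-fits b l)

altDown-alternating : ∀ l → altDown l ≡ fits 0 (alternating (length l)) l
altDown-alternating []      = refl
altDown-alternating (a ∷ l) = altDown-fits a l

oneTo-increasing : ∀ m → AllPairs _<_ (oneTo m)
oneTo-increasing m = AllPairs.map⁺ (AllPairs.applyUpTo⁺₁ id m (λ i<j _ → s<s i<j))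

length-oneTo : ∀ m → length (oneTo m) ≡ m
length-oneTo m = trans (length-map suc (upTo m)) (length-upTo m)

Euler≡extensions : ∀ m → Euler m ≡ extensions m (alternating m)
Euler≡extensions m = begin
  countTrue (map altDown (permutations (oneTo m)))
    ≡⟨ countTrue-map altDown (permutations (oneTo m)) ⟩
  sum (map (ind ∘ altDown) (permutations (oneTo m)))
    ≡⟨ cong sum (map-cong-local (All.map alternating-fits (permutations-↭ (oneTo m)))) ⟩
  sum (map (ind ∘ fits 0 (alternating m)) (permutations (oneTo m)))
    ≡⟨ permutations-fits (oneTo-increasing m) (alternating-startsFree m) (trans (length-alternating m) (sym (length-oneTo m))) 0 ⟩
  extensions (length (oneTo m)) (alternating m)
    ≡⟨ cong (λ n → extensions n (alternating m)) (length-oneTo m) ⟩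
  extensions m (alternating m) ∎
  where
  open ≡-Reasoning
  alternating-fits : ∀ {l} → l ↭ oneTo m → ind (altDown l) ≡ ind (fits 0 (alternating m) l)
  alternating-fits {l} l↭ = cong ind (trans (altDown-alternating l)
    (cong (λ n → fits 0 (alternating n) l) (trans (↭-length l↭) (length-oneTo m))))
  alternating-startsFree : ∀ m → StartsFree (alternating m)
  alternating-startsFree zero    = []
  alternating-startsFree (suc m) = free∷ _

reverseSteps : List Step → List Step
reverseSteps es = reverse (map mirror es)

reversePattern : List Step → List Step
reversePattern []       = []
reversePattern (_ ∷ es) = free ∷ reverseSteps es

reverseSteps-++ : ∀ xs ys → reverseSteps (xs ++ ys) ≡ reverseSteps ys ++ reverseSteps xs
reverseSteps-++ xs ys = trans (cong reverse (map-++ mirror xs ys)) (reverse-++ (map mirror xs) _)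

reverseSteps-reverse : ∀ xs → reverseSteps (reverse xs) ≡ map mirror xs
reverseSteps-reverse xs = trans (cong reverse (reverse-map mirror xs)) (reverse-involutive _)

headNotUp : List Step → Bool
headNotUp []      = true
headNotUp (s ∷ _) = notUp s

-- A position of the pattern free ∷ es is given by the steps up to it, nearest first (L), and the steps
-- after it (R); joinAround L R is the pattern left when that position is removed.
joinAround : List Step → List Step → List Step
joinAround []      []      = []
joinAround []      (_ ∷ R) = free ∷ R
joinAround (_ ∷ L) []      = free ∷ reverse L
joinAround (_ ∷ L) (_ ∷ R) = free ∷ reverse L ++ free ∷ R

removalHere : List Step → List Step → List (List Step)
removalHere L R = if headNotUp L ∧ headNotDown R then joinAround L R ∷ [] else []

removalsAfter : List Step → List Step → List (List Step)
removalsAfter L []      = removalHere L []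
removalsAfter L (r ∷ R) = removalHere L (r ∷ R) ++ removalsAfter (r ∷ L) R

removalsBefore : List Step → List Step → List (List Step)
removalsBefore []      R = []
removalsBefore (l ∷ L) R = removalsBefore L (l ∷ R) ++ removalHere L (l ∷ R)

reverse-cons-++ : ∀ {A : Set} (x : A) xs ys → reverse (x ∷ xs) ++ ys ≡ reverse xs ++ x ∷ ys
reverse-cons-++ x xs ys = trans (cong (_++ ys) (unfold-reverse x xs)) (++-assoc (reverse xs) (x ∷ []) ys)

removalsAfter-removals : ∀ e L es →
  removalsAfter (e ∷ L) es ≡ map (λ q → free ∷ reverse L ++ q) (removals (e ∷ es))
removalsAfter-removals e L [] with notUp e
... | true  = cong (λ q → (free ∷ q) ∷ []) (sym (++-identityʳ (reverse L)))
... | false = refl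
removalsAfter-removals e L (r ∷ R) = begin
  removalHere (e ∷ L) (r ∷ R) ++ removalsAfter (r ∷ e ∷ L) R
    ≡⟨ cong₂ _++_ (head-removal (notUp e ∧ notDown r)) (removalsAfter-removals r (e ∷ L) R) ⟩
  map (λ q → free ∷ reverse L ++ q) (removeHead e (r ∷ R)) ++ map (λ q → free ∷ reverse (e ∷ L) ++ q) (removals (r ∷ R))
    ≡⟨ cong (map (λ q → free ∷ reverse L ++ q) (removeHead e (r ∷ R)) ++_)
         (trans (map-cong (λ q → cong (free ∷_) (reverse-cons-++ e L q)) (removals (r ∷ R))) (map-∘ (removals (r ∷ R)))) ⟩
  map (λ q → free ∷ reverse L ++ q) (removeHead e (r ∷ R)) ++ map (λ q → free ∷ reverse L ++ q) (map (e ∷_) (removals (r ∷ R)))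
    ≡⟨ map-++ (λ q → free ∷ reverse L ++ q) (removeHead e (r ∷ R)) _ ⟨
  map (λ q → free ∷ reverse L ++ q) (removals (e ∷ r ∷ R)) ∎
  where
  open ≡-Reasoning
  head-removal : ∀ b → (if b then (free ∷ reverse L ++ free ∷ R) ∷ [] else [])
                     ≡ map (λ q → free ∷ reverse L ++ q) (if b then (free ∷ R) ∷ [] else [])
  head-removal true  = refl
  head-removal false = refl

removals≡removalsAfter : ∀ es → removals (free ∷ es) ≡ removalsAfter [] es
removals≡removalsAfter []      = refl
removals≡removalsAfter (r ∷ R) = cong (removeHead free (r ∷ R) ++_) (sym (removalsAfter-removals r [] R))

removalsBefore-++-removalsAfter : ∀ L R → removalsBefore L R ++ removalsAfter L R ≡ removalsAfter [] (reverse L ++ R)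
removalsBefore-++-removalsAfter []      R = refl
removalsBefore-++-removalsAfter (l ∷ L) R = begin
  (removalsBefore L (l ∷ R) ++ removalHere L (l ∷ R)) ++ removalsAfter (l ∷ L) R
    ≡⟨ ++-assoc (removalsBefore L (l ∷ R)) _ _ ⟩
  removalsBefore L (l ∷ R) ++ removalsAfter L (l ∷ R)
    ≡⟨ removalsBefore-++-removalsAfter L (l ∷ R) ⟩
  removalsAfter [] (reverse L ++ l ∷ R)
    ≡⟨ cong (removalsAfter []) (reverse-cons-++ l L R) ⟨
  removalsAfter [] (reverse (l ∷ L) ++ R) ∎
  where open ≡-Reasoning

headNotUp-mirror : ∀ R → headNotUp (map mirror R) ≡ headNotDown R
headNotUp-mirror []          = refl
headNotUp-mirror (free ∷ _)  = refl
headNotUp-mirror (down ∷ _)  = refl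
headNotUp-mirror (up ∷ _)    = refl

headNotDown-mirror : ∀ L → headNotDown (map mirror L) ≡ headNotUp L
headNotDown-mirror []          = refl
headNotDown-mirror (free ∷ _)  = refl
headNotDown-mirror (down ∷ _)  = refl
headNotDown-mirror (up ∷ _)    = refl

joinAround-mirror : ∀ L R → joinAround (map mirror R) (map mirror L) ≡ reversePattern (joinAround L R)
joinAround-mirror []      []      = refl
joinAround-mirror []      (_ ∷ R) = refl
joinAround-mirror (_ ∷ L) []      = cong (free ∷_) (sym (reverseSteps-reverse L))
joinAround-mirror (_ ∷ L) (_ ∷ R) = cong (free ∷_) (sym (begin
  reverseSteps (reverse L ++ free ∷ R)             ≡⟨ reverseSteps-++ (reverse L) (free ∷ R) ⟩
  reverseSteps (free ∷ R) ++ reverseSteps (reverse L) ≡⟨ cong₂ _++_ (unfold-reverse free (map mirror R)) (reverseSteps-reverse L) ⟩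
  (reverseSteps R ∷ʳ free) ++ map mirror L          ≡⟨ ++-assoc (reverseSteps R) (free ∷ []) _ ⟩
  reverseSteps R ++ free ∷ map mirror L             ∎))
  where open ≡-Reasoning

removalHere-mirror : ∀ L R → removalHere (map mirror R) (map mirror L) ≡ map reversePattern (removalHere L R)
removalHere-mirror L R
  rewrite headNotUp-mirror R | headNotDown-mirror L | BP.∧-comm (headNotDown R) (headNotUp L)
  with headNotUp L ∧ headNotDown R
... | true  = cong (_∷ []) (joinAround-mirror L R)
... | false = refl

reverse-removalHere : ∀ L R → reverse (removalHere L R) ≡ removalHere L R
reverse-removalHere L R with headNotUp L ∧ headNotDown R
... | true  = refl
... | false = refl

reverse-removalsAfter : ∀ L R →
  reverse (map reversePattern (removalsAfter L R))
    ≡ removalsBefore (map mirror R) (map mirror L) ++ removalHere (map mirror R) (map mirror L)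
reverse-removalsAfter L [] = trans (cong reverse (sym (removalHere-mirror L []))) (reverse-removalHere [] (map mirror L))
reverse-removalsAfter L (r ∷ R) = begin
  reverse (map reversePattern (removalHere L (r ∷ R) ++ removalsAfter (r ∷ L) R))
    ≡⟨ cong reverse (map-++ reversePattern (removalHere L (r ∷ R)) _) ⟩
  reverse (map reversePattern (removalHere L (r ∷ R)) ++ map reversePattern (removalsAfter (r ∷ L) R))
    ≡⟨ reverse-++ (map reversePattern (removalHere L (r ∷ R))) _ ⟩
  reverse (map reversePattern (removalsAfter (r ∷ L) R)) ++ reverse (map reversePattern (removalHere L (r ∷ R)))
    ≡⟨ cong₂ _++_ (reverse-removalsAfter (r ∷ L) R)
         (trans (cong reverse (sym (removalHere-mirror L (r ∷ R)))) (reverse-removalHere _ _)) ⟩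
  removalsBefore (map mirror (r ∷ R)) (map mirror L) ++ removalHere (map mirror (r ∷ R)) (map mirror L) ∎
  where open ≡-Reasoning

removals-reversePattern : ∀ es → removals (reversePattern (free ∷ es)) ≡ reverse (map reversePattern (removals (free ∷ es)))
removals-reversePattern es = begin
  removals (free ∷ reverseSteps es)
    ≡⟨ removals≡removalsAfter (reverseSteps es) ⟩
  removalsAfter [] (reverseSteps es)
    ≡⟨ cong (removalsAfter []) (++-identityʳ (reverseSteps es)) ⟨
  removalsAfter [] (reverse (map mirror es) ++ [])
    ≡⟨ removalsBefore-++-removalsAfter (map mirror es) [] ⟨
  removalsBefore (map mirror es) [] ++ removalsAfter (map mirror es) []
    ≡⟨ reverse-removalsAfter [] es ⟨
  reverse (map reversePattern (removalsAfter [] es))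
    ≡⟨ cong (reverse ∘ map reversePattern) (removals≡removalsAfter es) ⟨
  reverse (map reversePattern (removals (free ∷ es))) ∎
  where open ≡-Reasoning

sum-map-reverse : ∀ {A : Set} (f : A → ℕ) xs → sum (map f (reverse xs)) ≡ sum (map f xs)
sum-map-reverse f xs = trans (cong sum (reverse-map f xs)) (sum-↭ (↭-reverse (map f xs)))

extensions-reversePattern : ∀ d {p} → StartsFree p → extensions d (reversePattern p) ≡ extensions d p
extensions-reversePattern zero    _          = refl
extensions-reversePattern (suc d) []         = refl
extensions-reversePattern (suc d) (free∷ es) = begin
  sum (map (extensions d) (removals (reversePattern (free ∷ es))))
    ≡⟨ cong (sum ∘ map (extensions d)) (removals-reversePattern es) ⟩
  sum (map (extensions d) (reverse (map reversePattern (removals (free ∷ es)))))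
    ≡⟨ sum-map-reverse (extensions d) (map reversePattern (removals (free ∷ es))) ⟩
  sum (map (extensions d) (map reversePattern (removals (free ∷ es))))
    ≡⟨ cong sum (map-∘ (removals (free ∷ es))) ⟨
  sum (map (extensions d ∘ reversePattern) (removals (free ∷ es)))
    ≡⟨ cong sum (map-cong-local (All.map (extensions-reversePattern d) (removals-startsFree (free∷ es)))) ⟩
  sum (map (extensions d) (removals (free ∷ es))) ∎
  where open ≡-Reasoning

mirror-zigzag : ∀ s m → map mirror (zigzag s m) ≡ zigzag (mirror s) m
mirror-zigzag s zero    = refl
mirror-zigzag s (suc m) = cong (mirror s ∷_) (mirror-zigzag (mirror s) m)

mirror-involutive : ∀ s → mirror (mirror s) ≡ s
mirror-involutive free = refl
mirror-involutive down = refl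
mirror-involutive up   = refl

zigzag-odd-suc : ∀ s j → zigzag s (suc (2 * suc j)) ≡ s ∷ mirror s ∷ zigzag s (suc (2 * j))
zigzag-odd-suc s j rewrite mirror-involutive s | +-suc j (j + 0) = refl

zigzag-odd-∷ʳ : ∀ s j → zigzag s (suc (2 * j)) ++ mirror s ∷ s ∷ [] ≡ s ∷ mirror s ∷ zigzag s (suc (2 * j))
zigzag-odd-∷ʳ s zero    = refl
zigzag-odd-∷ʳ s (suc j) = begin
  zigzag s (suc (2 * suc j)) ++ mirror s ∷ s ∷ []
    ≡⟨ cong (_++ mirror s ∷ s ∷ []) (zigzag-odd-suc s j) ⟩
  s ∷ mirror s ∷ (zigzag s (suc (2 * j)) ++ mirror s ∷ s ∷ [])
    ≡⟨ cong (λ z → s ∷ mirror s ∷ z) (trans (zigzag-odd-∷ʳ s j) (sym (zigzag-odd-suc s j))) ⟩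
  s ∷ mirror s ∷ zigzag s (suc (2 * suc j)) ∎
  where open ≡-Reasoning

zigzag-odd-palindrome : ∀ s j → reverse (zigzag s (suc (2 * j))) ≡ zigzag s (suc (2 * j))
zigzag-odd-palindrome s zero    = refl
zigzag-odd-palindrome s (suc j) = begin
  reverse (zigzag s (suc (2 * suc j)))                     ≡⟨ cong reverse (zigzag-odd-suc s j) ⟩
  reverse ((s ∷ mirror s ∷ []) ++ zigzag s (suc (2 * j)))  ≡⟨ reverse-++ (s ∷ mirror s ∷ []) (zigzag s (suc (2 * j))) ⟩
  reverse (zigzag s (suc (2 * j))) ++ mirror s ∷ s ∷ []     ≡⟨ cong (_++ mirror s ∷ s ∷ []) (zigzag-odd-palindrome s j) ⟩
  zigzag s (suc (2 * j)) ++ mirror s ∷ s ∷ []               ≡⟨ zigzag-odd-∷ʳ s j ⟩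
  s ∷ mirror s ∷ zigzag s (suc (2 * j))                     ≡⟨ zigzag-odd-suc s j ⟨
  zigzag s (suc (2 * suc j))                                ∎
  where open ≡-Reasoning

Euler≡extensions-up : ∀ j → Euler (suc (suc (2 * j))) ≡ extensions (suc (suc (2 * j))) (free ∷ zigzag up (suc (2 * j)))
Euler≡extensions-up j = begin
  Euler m                                              ≡⟨ Euler≡extensions m ⟩
  extensions m (alternating m)                         ≡⟨ extensions-reversePattern m (free∷ (zigzag down (suc (2 * j)))) ⟨
  extensions m (free ∷ reverse (map mirror (zigzag down (suc (2 * j)))))
    ≡⟨ cong (λ z → extensions m (free ∷ reverse z)) (mirror-zigzag down (suc (2 * j))) ⟩
  extensions m (free ∷ reverse (zigzag up (suc (2 * j))))
    ≡⟨ cong (λ z → extensions m (free ∷ z)) (zigzag-odd-palindrome up j) ⟩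
  extensions m (free ∷ zigzag up (suc (2 * j)))        ∎
  where
  open ≡-Reasoning
  m : ℕ
  m = suc (suc (2 * j))

-- Shortest paths in the Alternate Lucas cube

-- bit w i is 0 past the end of w.
bit : BinStr → ℕ → Bool
bit []       _       = false
bit (x ∷ _)  zero    = x
bit (_ ∷ xs) (suc i) = bit xs i

hamming : BinStr → BinStr → ℕ
hamming (x ∷ xs) (y ∷ ys) = if x xor y then suc (hamming xs ys) else hamming xs ys
hamming _        _        = 0

-- Two adjacent coordinates where w and v differ must be flipped so that 11 never appears: the 1 of w
-- first.  diffSteps records nothing where w and v agree and the resulting step where they differ; the
-- flag tells whether the previous coordinate differs too.
stepFor : Bool → Bool → Step
stepFor false _     = free
stepFor true  true  = down
stepFor true  false = up

diffSteps : Bool → BinStr → BinStr → List (Maybe Step)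
diffSteps p (x ∷ xs) (y ∷ ys) = (if x xor y then just (stepFor p x) else nothing) ∷ diffSteps (x xor y) xs ys
diffSteps _ _        _        = []

diffPattern : BinStr → BinStr → List Step
diffPattern w v = catMaybes (diffSteps false w v)

freeFirst : List (Maybe Step) → List (Maybe Step)
freeFirst []             = []
freeFirst (nothing ∷ cs) = nothing ∷ freeFirst cs
freeFirst (just _ ∷ cs)  = just free ∷ cs

clearAt : ℕ → List (Maybe Step) → List (Maybe Step)
clearAt _       []       = []
clearAt zero    (_ ∷ cs) = nothing ∷ freeFirst cs
clearAt (suc i) (c ∷ cs) = c ∷ clearAt i cs

leastAt : ℕ → List (Maybe Step) → Bool
leastAt _       []             = false
leastAt zero    (nothing ∷ _)  = false
leastAt zero    (just s ∷ cs)  = notUp s ∧ headNotDown (catMaybes cs)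
leastAt (suc i) (_ ∷ cs)       = leastAt i cs

catMaybes-freeFirst : ∀ cs → catMaybes (freeFirst cs) ≡ freeHead (catMaybes cs)
catMaybes-freeFirst []             = refl
catMaybes-freeFirst (nothing ∷ cs) = catMaybes-freeFirst cs
catMaybes-freeFirst (just _ ∷ cs)  = refl

sum-map-removeHead : ∀ (F : List Step → ℕ) s ss →
  sum (map F (removeHead s ss)) ≡ (if notUp s ∧ headNotDown ss then F (freeHead ss) else 0)
sum-map-removeHead F s ss with notUp s ∧ headNotDown ss
... | true  = +-identityʳ _
... | false = refl

removalAt : (List Step → ℕ) → List (Maybe Step) → ℕ → ℕ
removalAt F cs i = if leastAt i cs then F (catMaybes (clearAt i cs)) else 0

sum-removalAt : ∀ (F : List Step → ℕ) cs →
  sum (map (removalAt F cs) (upTo (length cs))) ≡ sum (map F (removals (catMaybes cs)))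
sum-removalAt F []             = refl
sum-removalAt F (nothing ∷ cs) = trans (sum-upTo-suc (removalAt F (nothing ∷ cs)) (length cs)) (sum-removalAt F cs)
sum-removalAt F (just s ∷ cs)  = begin
  sum (map (removalAt F (just s ∷ cs)) (upTo (suc (length cs))))
    ≡⟨ sum-upTo-suc (removalAt F (just s ∷ cs)) (length cs) ⟩
  removalAt F (just s ∷ cs) 0 + sum (map (removalAt (F ∘ (s ∷_)) cs) (upTo (length cs)))
    ≡⟨ cong₂ _+_ first (sum-removalAt (F ∘ (s ∷_)) cs) ⟩
  sum (map F (removeHead s (catMaybes cs))) + sum (map (F ∘ (s ∷_)) (removals (catMaybes cs)))
    ≡⟨ cong (sum (map F (removeHead s (catMaybes cs))) +_) (cong sum (map-∘ (removals (catMaybes cs)))) ⟩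
  sum (map F (removeHead s (catMaybes cs))) + sum (map F (map (s ∷_) (removals (catMaybes cs))))
    ≡⟨ sum-map-++ F (removeHead s (catMaybes cs)) _ ⟨
  sum (map F (removals (s ∷ catMaybes cs))) ∎
  where
  open ≡-Reasoning
  first : removalAt F (just s ∷ cs) 0 ≡ sum (map F (removeHead s (catMaybes cs)))
  first = trans (cong (λ q → if notUp s ∧ headNotDown (catMaybes cs) then F q else 0) (catMaybes-freeFirst cs))
                (sym (sum-map-removeHead F s (catMaybes cs)))

freeFirst-diffSteps : ∀ p xs ys → freeFirst (diffSteps p xs ys) ≡ diffSteps false xs ys
freeFirst-diffSteps p []           _            = refl
freeFirst-diffSteps p (_ ∷ _)      []           = refl
freeFirst-diffSteps p (true ∷ xs)  (false ∷ ys) = refl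
freeFirst-diffSteps p (false ∷ xs) (true ∷ ys)  = refl
freeFirst-diffSteps p (true ∷ xs)  (true ∷ ys)  = cong (nothing ∷_) (freeFirst-diffSteps false xs ys)
freeFirst-diffSteps p (false ∷ xs) (false ∷ ys) = cong (nothing ∷_) (freeFirst-diffSteps false xs ys)

diffSteps-flipAt : ∀ i p w v → bit v i ≡ not (bit w i) → diffSteps p (flipAt i w) v ≡ clearAt i (diffSteps p w v)
diffSteps-flipAt i       p []           v            _  = refl
diffSteps-flipAt zero    p (_ ∷ _)      []           _  = refl
diffSteps-flipAt zero    p (true ∷ xs)  (false ∷ ys) _  = cong (nothing ∷_) (sym (freeFirst-diffSteps true xs ys))
diffSteps-flipAt zero    p (false ∷ xs) (true ∷ ys)  _  = cong (nothing ∷_) (sym (freeFirst-diffSteps true xs ys))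
diffSteps-flipAt (suc i) p (x ∷ xs)     []           _  = refl
diffSteps-flipAt (suc i) p (x ∷ xs)     (y ∷ ys)     ne = cong (_ ∷_) (diffSteps-flipAt i (x xor y) xs ys ne)

leastAt-agree : ∀ i p w v → bit v i ≡ bit w i → leastAt i (diffSteps p w v) ≡ false
leastAt-agree i       p []           _            _  = refl
leastAt-agree i       p (_ ∷ _)      []           _  = refl
leastAt-agree zero    p (true ∷ _)   (true ∷ _)   _  = refl
leastAt-agree zero    p (false ∷ _)  (false ∷ _)  _  = refl
leastAt-agree (suc i) p (x ∷ xs)     (y ∷ ys)     eq = leastAt-agree i (x xor y) xs ys eq

noConsec11-∷∷ : ∀ a b r → noConsec11 (a ∷ b ∷ r) ≡ not (a ∧ b) ∧ noConsec11 (b ∷ r)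
noConsec11-∷∷ true  true  r = refl
noConsec11-∷∷ true  false r = refl
noConsec11-∷∷ false b     r = refl

headNotDown-diffSteps : ∀ xs ys → headNotDown (catMaybes (diffSteps false xs ys)) ≡ true
headNotDown-diffSteps []           _            = refl
headNotDown-diffSteps (_ ∷ _)      []           = refl
headNotDown-diffSteps (true ∷ xs)  (false ∷ ys) = refl
headNotDown-diffSteps (false ∷ xs) (true ∷ ys)  = refl
headNotDown-diffSteps (true ∷ xs)  (true ∷ ys)  = headNotDown-diffSteps xs ys
headNotDown-diffSteps (false ∷ xs) (false ∷ ys) = headNotDown-diffSteps xs ys

∧-true : ∀ a {b} → a ∧ b ≡ true → a ≡ true × b ≡ true
∧-true true h = refl , h

noConsec11-tail : ∀ a xs → noConsec11 (a ∷ xs) ≡ true → noConsec11 xs ≡ true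
noConsec11-tail false xs          h = h
noConsec11-tail true  []          h = refl
noConsec11-tail true  (false ∷ _) h = h

headNotDown-after-true : ∀ xs ys → noConsec11 (true ∷ xs) ≡ true → headNotDown (catMaybes (diffSteps true xs ys)) ≡ true
headNotDown-after-true []           _            _ = refl
headNotDown-after-true (_ ∷ _)      []           _ = refl
headNotDown-after-true (false ∷ xs) (true ∷ ys)  _ = refl
headNotDown-after-true (false ∷ xs) (false ∷ ys) _ = headNotDown-diffSteps xs ys

-- pw and pv are the bits preceding w and v.
noConsec11-flipAt : ∀ i pw pv w v → noConsec11 (pw ∷ w) ≡ true → noConsec11 (pv ∷ v) ≡ true →
  bit v i ≡ not (bit w i) → length w ≡ length v →
  noConsec11 (pw ∷ flipAt i w) ≡ leastAt i (diffSteps (pw xor pv) w v)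
noConsec11-flipAt i       pw    pv    []           []           _  _  () _
noConsec11-flipAt zero    false false (true ∷ xs)  (false ∷ ys) w₁ _  _  _ =
  trans (noConsec11-tail true xs w₁) (sym (headNotDown-after-true xs ys w₁))
noConsec11-flipAt zero    false true  (true ∷ xs)  (false ∷ ys) w₁ _  _  _ =
  trans (noConsec11-tail true xs w₁) (sym (headNotDown-after-true xs ys w₁))
noConsec11-flipAt zero    true  false (false ∷ xs) (true ∷ ys)  _  _  _  _ = refl
noConsec11-flipAt zero    false false (false ∷ xs) (true ∷ ys)  w₁ v₁ _  l = after-0 xs ys w₁ v₁ (suc-injective l)
  where
  after-0 : ∀ xs ys → noConsec11 xs ≡ true → noConsec11 (true ∷ ys) ≡ true → length xs ≡ length ys →
    noConsec11 (true ∷ xs) ≡ headNotDown (catMaybes (diffSteps true xs ys))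
  after-0 []           []           _  _ _ = refl
  after-0 (true ∷ xs)  (false ∷ ys) _  _ _ = refl
  after-0 (false ∷ xs) (true ∷ ys)  w₀ _ _ = w₀
  after-0 (false ∷ xs) (false ∷ ys) w₀ _ _ = trans w₀ (sym (headNotDown-diffSteps xs ys))
noConsec11-flipAt (suc i) pw    pv    (x ∷ xs)     (y ∷ ys)     w₁ v₁ ne l
  with ∧-true (not (pw ∧ x)) (trans (sym (noConsec11-∷∷ pw x xs)) w₁)
     | ∧-true (not (pv ∧ y)) (trans (sym (noConsec11-∷∷ pv y ys)) v₁)
... | pw-x , w₀ | _ , v₀ = begin
  noConsec11 (pw ∷ x ∷ flipAt i xs)            ≡⟨ noConsec11-∷∷ pw x (flipAt i xs) ⟩
  not (pw ∧ x) ∧ noConsec11 (x ∷ flipAt i xs)  ≡⟨ cong (_∧ noConsec11 (x ∷ flipAt i xs)) pw-x ⟩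
  noConsec11 (x ∷ flipAt i xs)                 ≡⟨ noConsec11-flipAt i x y xs ys w₀ v₀ ne (suc-injective l) ⟩
  leastAt i (diffSteps (x xor y) xs ys)        ∎
  where open ≡-Reasoning

hamming-flipAt-differ : ∀ i w v → bit v i ≡ not (bit w i) → length w ≡ length v →
  suc (hamming (flipAt i w) v) ≡ hamming w v
hamming-flipAt-differ i       []           []           () _
hamming-flipAt-differ zero    (true ∷ xs)  (false ∷ ys) _  _ = refl
hamming-flipAt-differ zero    (false ∷ xs) (true ∷ ys)  _  _ = refl
hamming-flipAt-differ (suc i) (x ∷ xs)     (y ∷ ys)     ne l with x xor y
... | true  = cong suc (hamming-flipAt-differ i xs ys ne (suc-injective l))
... | false = hamming-flipAt-differ i xs ys ne (suc-injective l)

hamming-flipAt-agree : ∀ i w v → bit v i ≡ bit w i → hamming w v ≤ hamming (flipAt i w) v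
hamming-flipAt-agree i       []           _            _  = ≤-refl
hamming-flipAt-agree i       (_ ∷ _)      []           _  = z≤n
hamming-flipAt-agree zero    (true ∷ xs)  (true ∷ ys)  _  = n≤1+n _
hamming-flipAt-agree zero    (false ∷ xs) (false ∷ ys) _  = n≤1+n _
hamming-flipAt-agree (suc i) (x ∷ xs)     (y ∷ ys)     eq with x xor y
... | true  = s≤s (hamming-flipAt-agree i xs ys eq)
... | false = hamming-flipAt-agree i xs ys eq

hamming-flipAt-≤ : ∀ i w v → hamming w v ≤ suc (hamming (flipAt i w) v)
hamming-flipAt-≤ i       []           _            = z≤n
hamming-flipAt-≤ i       (_ ∷ _)      []           = z≤n
hamming-flipAt-≤ zero    (true ∷ xs)  (true ∷ ys)  = m≤n⇒m≤1+n (n≤1+n _)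
hamming-flipAt-≤ zero    (false ∷ xs) (false ∷ ys) = m≤n⇒m≤1+n (n≤1+n _)
hamming-flipAt-≤ zero    (true ∷ xs)  (false ∷ ys) = ≤-refl
hamming-flipAt-≤ zero    (false ∷ xs) (true ∷ ys)  = ≤-refl
hamming-flipAt-≤ (suc i) (x ∷ xs)     (y ∷ ys)     with x xor y
... | true  = s≤s (hamming-flipAt-≤ i xs ys)
... | false = hamming-flipAt-≤ i xs ys

hamming-self : ∀ w → hamming w w ≡ 0
hamming-self []          = refl
hamming-self (true ∷ w)  = hamming-self w
hamming-self (false ∷ w) = hamming-self w

hamming≡0 : ∀ w v → length w ≡ length v → hamming w v ≡ 0 → w ≡ v
hamming≡0 []           []           _ _ = refl
hamming≡0 (true ∷ xs)  (true ∷ ys)  l h = cong (true ∷_) (hamming≡0 xs ys (suc-injective l) h)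
hamming≡0 (false ∷ xs) (false ∷ ys) l h = cong (false ∷_) (hamming≡0 xs ys (suc-injective l) h)

hamming≤length : ∀ w v → hamming w v ≤ length w
hamming≤length []       _        = z≤n
hamming≤length (_ ∷ _)  []       = z≤n
hamming≤length (x ∷ xs) (y ∷ ys) with x xor y
... | true  = s≤s (hamming≤length xs ys)
... | false = m≤n⇒m≤1+n (hamming≤length xs ys)

length-catMaybes-diffSteps : ∀ p w v → length (catMaybes (diffSteps p w v)) ≡ hamming w v
length-catMaybes-diffSteps p []           _            = refl
length-catMaybes-diffSteps p (_ ∷ _)      []           = refl
length-catMaybes-diffSteps p (true ∷ xs)  (true ∷ ys)  = length-catMaybes-diffSteps false xs ys
length-catMaybes-diffSteps p (false ∷ xs) (false ∷ ys) = length-catMaybes-diffSteps false xs ys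
length-catMaybes-diffSteps p (true ∷ xs)  (false ∷ ys) = cong suc (length-catMaybes-diffSteps true xs ys)
length-catMaybes-diffSteps p (false ∷ xs) (true ∷ ys)  = cong suc (length-catMaybes-diffSteps true xs ys)

diffPattern-startsFree : ∀ w v → StartsFree (diffPattern w v)
diffPattern-startsFree []           _            = []
diffPattern-startsFree (_ ∷ _)      []           = []
diffPattern-startsFree (true ∷ xs)  (true ∷ ys)  = diffPattern-startsFree xs ys
diffPattern-startsFree (false ∷ xs) (false ∷ ys) = diffPattern-startsFree xs ys
diffPattern-startsFree (true ∷ xs)  (false ∷ ys) = free∷ _
diffPattern-startsFree (false ∷ xs) (true ∷ ys)  = free∷ _

eqStr-refl : ∀ w → eqStr w w ≡ true
eqStr-refl w with ≡-dec BP._≟_ w w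
... | yes _  = refl
... | no w≢w = contradiction refl w≢w

eqStr-≢ : ∀ {w v} → w ≢ v → eqStr w v ≡ false
eqStr-≢ {w} {v} w≢v with ≡-dec BP._≟_ w v
... | yes w≡v = contradiction w≡v w≢v
... | no _    = refl

walks-below-hamming : ∀ m w v → m < hamming w v → walks m w v ≡ 0
walks-below-hamming zero    w v 0<h = cong (λ b → if b then 1 else 0) (eqStr-≢ w≢v)
  where
  w≢v : w ≢ v
  w≢v refl = <⇒≢ 0<h (sym (hamming-self w))
walks-below-hamming (suc m) w v m<h = sum-map-≡0 vanish (upTo (length w))
  where
  vanish : ∀ i → (if inAltLucas (flipAt i w) then walks m (flipAt i w) v else 0) ≡ 0
  vanish i with inAltLucas (flipAt i w)
  ... | true  = walks-below-hamming m (flipAt i w) v (s≤s⁻¹ (≤-trans m<h (hamming-flipAt-≤ i w v)))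
  ... | false = refl

data EndsWith3 : BinStr → Set where
  _++[_,_,_] : ∀ ys a b c → EndsWith3 (ys ++ a ∷ b ∷ c ∷ [])

∷-endsWith3 : ∀ a {x} → EndsWith3 x → EndsWith3 (a ∷ x)
∷-endsWith3 a (ys ++[ x , y , z ]) = (a ∷ ys) ++[ x , y , z ]

endsWith3 : ∀ x → 3 ≤ length x → EndsWith3 x
endsWith3 (a ∷ b ∷ c ∷ [])    _              = [] ++[ a , b , c ]
endsWith3 (a ∷ b ∷ c ∷ d ∷ r) _              = ∷-endsWith3 a (endsWith3 (b ∷ c ∷ d ∷ r) (s≤s (s≤s (s≤s z≤n))))
endsWith3 (_ ∷ [])            (s≤s ())
endsWith3 (_ ∷ _ ∷ [])        (s≤s (s≤s ()))

lastTriple : BinStr → Bool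
lastTriple (c ∷ _ ∷ a ∷ _) = not (c ∧ a)
lastTriple _               = true

lastCond≡lastTriple : ∀ x → lastCond x ≡ lastTriple (reverse x)
lastCond≡lastTriple x with reverse x
... | _ ∷ _ ∷ _ ∷ _ = refl
... | []            = refl
... | _ ∷ []        = refl
... | _ ∷ _ ∷ []    = refl

lastCond-++ : ∀ ys a b c → lastCond (ys ++ a ∷ b ∷ c ∷ []) ≡ not (c ∧ a)
lastCond-++ ys a b c = trans (lastCond≡lastTriple (ys ++ a ∷ b ∷ c ∷ [])) (cong lastTriple (reverse-++ ys (a ∷ b ∷ c ∷ [])))

bit-++ : ∀ xs ys j → bit (xs ++ ys) (length xs + j) ≡ bit ys j
bit-++ []       ys j = refl
bit-++ (_ ∷ xs) ys j = bit-++ xs ys j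

-- A coordinate, the last or the third to last, where w and v are both 0: it stays 0 along every shortest
-- path from w to v, so the condition b_{n-2} b_n = 0 of the Alternate Lucas cube never binds there.
Guard : BinStr → BinStr → Set
Guard w v = Σ[ j ∈ ℕ ] (j + 3 ≡ length w ⊎ j + 1 ≡ length w) × bit w j ≡ false × bit v j ≡ false

lastCond-endsWith3 : ∀ {x} j → EndsWith3 x → (j + 3 ≡ length x ⊎ j + 1 ≡ length x) → bit x j ≡ false →
  lastCond x ≡ true
lastCond-endsWith3 j (ys ++[ a , b , c ]) pos x-j = trans (lastCond-++ ys a b c) (end pos)
  where
  length≡ : length (ys ++ a ∷ b ∷ c ∷ []) ≡ length ys + 2 + 1
  length≡ = trans (length-++ ys) (sym (+-assoc (length ys) 2 1))
  end : (j + 3 ≡ length (ys ++ a ∷ b ∷ c ∷ []) ⊎ j + 1 ≡ length (ys ++ a ∷ b ∷ c ∷ [])) → not (c ∧ a) ≡ true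
  end (inj₁ j+3≡) with +-cancelʳ-≡ 3 j (length ys) (trans j+3≡ (length-++ ys))
  ... | refl = trans (cong (λ a → not (c ∧ a)) a≡false) (cong not (BP.∧-zeroʳ c))
    where
    a≡false : a ≡ false
    a≡false = trans (sym (trans (cong (bit (ys ++ _)) (sym (+-identityʳ (length ys)))) (bit-++ ys _ 0))) x-j
  end (inj₂ j+1≡) with +-cancelʳ-≡ 1 j (length ys + 2) (trans j+1≡ length≡)
  ... | refl = cong (λ c → not (c ∧ a)) (trans (sym (bit-++ ys _ 2)) x-j)

lastCond-guard : ∀ x j → (j + 3 ≡ length x ⊎ j + 1 ≡ length x) → bit x j ≡ false → lastCond x ≡ true
lastCond-guard []              _ _ _ = refl
lastCond-guard (_ ∷ [])        _ _ _ = refl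
lastCond-guard (_ ∷ _ ∷ [])    _ _ _ = refl
lastCond-guard x@(_ ∷ _ ∷ _ ∷ _) j  = lastCond-endsWith3 j (endsWith3 x (s≤s (s≤s (s≤s z≤n))))

bit-flipAt-≢ : ∀ i j w → i ≢ j → bit (flipAt i w) j ≡ bit w j
bit-flipAt-≢ i       j       []      _   = refl
bit-flipAt-≢ zero    zero    (_ ∷ _) i≢j = contradiction refl i≢j
bit-flipAt-≢ zero    (suc j) (_ ∷ _) _   = refl
bit-flipAt-≢ (suc i) zero    (_ ∷ _) _   = refl
bit-flipAt-≢ (suc i) (suc j) (_ ∷ w) i≢j = bit-flipAt-≢ i j w (i≢j ∘ cong suc)

length-flipAt : ∀ i w → length (flipAt i w) ≡ length w
length-flipAt i       []      = refl
length-flipAt zero    (_ ∷ _) = refl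
length-flipAt (suc i) (_ ∷ w) = cong suc (length-flipAt i w)

guard-flipAt : ∀ i {w v} → bit v i ≡ not (bit w i) → Guard w v → Guard (flipAt i w) v
guard-flipAt i {w} {v} ne (j , pos , w-j , v-j) =
  j , subst (λ n → j + 3 ≡ n ⊎ j + 1 ≡ n) (sym (length-flipAt i w)) pos , trans (bit-flipAt-≢ i j w i≢j) w-j , v-j
  where
  i≢j : i ≢ j
  i≢j refl with bit w i
  i≢j refl | false = contradiction (trans (sym v-j) ne) λ ()
  i≢j refl | true  = contradiction w-j λ ()

record GuardedPair (w v : BinStr) : Set where
  field
    w∈      : inAltLucas w ≡ true
    v∈      : inAltLucas v ≡ true
    length≡ : length w ≡ length v
    guard   : Guard w v

inAltLucas-flipAt : ∀ i {w v} → GuardedPair w v → bit v i ≡ not (bit w i) →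
  inAltLucas (flipAt i w) ≡ leastAt i (diffSteps false w v)
inAltLucas-flipAt i {w} {v} gp ne with guard-flipAt i {w} {v} ne (GuardedPair.guard gp)
... | j , pos , w′-j , _ = begin
  noConsec11 (flipAt i w) ∧ lastCond (flipAt i w)
    ≡⟨ cong (noConsec11 (flipAt i w) ∧_) (lastCond-guard (flipAt i w) j pos w′-j) ⟩
  noConsec11 (flipAt i w) ∧ true
    ≡⟨ BP.∧-identityʳ _ ⟩
  noConsec11 (false ∷ flipAt i w)
    ≡⟨ noConsec11-flipAt i false false w v (proj₁ (∧-true _ (GuardedPair.w∈ gp))) (proj₁ (∧-true _ (GuardedPair.v∈ gp)))
         ne (GuardedPair.length≡ gp) ⟩
  leastAt i (diffSteps false w v) ∎
  where open ≡-Reasoning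

guardedPair-flipAt : ∀ i {w v} → GuardedPair w v → bit v i ≡ not (bit w i) →
  leastAt i (diffSteps false w v) ≡ true → GuardedPair (flipAt i w) v
guardedPair-flipAt i {w} {v} gp ne least = record
  { w∈      = trans (inAltLucas-flipAt i gp ne) least
  ; v∈      = GuardedPair.v∈ gp
  ; length≡ = trans (length-flipAt i w) (GuardedPair.length≡ gp)
  ; guard   = guard-flipAt i {w} {v} ne (GuardedPair.guard gp)
  }

length-diffSteps : ∀ p w v → length w ≡ length v → length (diffSteps p w v) ≡ length w
length-diffSteps p []       []       _ = refl
length-diffSteps p (x ∷ xs) (y ∷ ys) l = cong suc (length-diffSteps (x xor y) xs ys (suc-injective l))

bit-agree-or-differ : ∀ w v i → bit v i ≡ bit w i ⊎ bit v i ≡ not (bit w i)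
bit-agree-or-differ w v i with bit w i | bit v i
... | true  | true  = inj₁ refl
... | false | false = inj₁ refl
... | true  | false = inj₂ refl
... | false | true  = inj₂ refl

walks-geodesic : ∀ d {w v} → GuardedPair w v → hamming w v ≡ d → walks d w v ≡ extensions d (diffPattern w v)
walks-geodesic zero    {w} {v} gp h≡0 rewrite hamming≡0 w v (GuardedPair.length≡ gp) h≡0 | eqStr-refl v = refl
walks-geodesic (suc d) {w} {v} gp h≡d = begin
  sum (map (λ i → if inAltLucas (flipAt i w) then walks d (flipAt i w) v else 0) (upTo (length w)))
    ≡⟨ cong sum (map-cong step (upTo (length w))) ⟩
  sum (map (removalAt (extensions d) cells) (upTo (length w)))
    ≡⟨ cong (λ n → sum (map (removalAt (extensions d) cells) (upTo n)))
         (sym (length-diffSteps false w v (GuardedPair.length≡ gp))) ⟩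
  sum (map (removalAt (extensions d) cells) (upTo (length cells)))
    ≡⟨ sum-removalAt (extensions d) cells ⟩
  sum (map (extensions d) (removals (diffPattern w v))) ∎
  where
  open ≡-Reasoning
  cells : List (Maybe Step)
  cells = diffSteps false w v
  step : ∀ i → (if inAltLucas (flipAt i w) then walks d (flipAt i w) v else 0) ≡ removalAt (extensions d) cells i
  step i with bit-agree-or-differ w v i
  ... | inj₁ agree rewrite leastAt-agree i false w v agree with inAltLucas (flipAt i w)
  ...   | true  = walks-below-hamming d (flipAt i w) v (<-≤-trans (≤-reflexive (sym h≡d)) (hamming-flipAt-agree i w v agree))
  ...   | false = refl
  step i | inj₂ differ rewrite inAltLucas-flipAt i gp differ with leastAt i cells in least
  ...   | true  = trans (walks-geodesic d (guardedPair-flipAt i gp differ least)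
                           (suc-injective (trans (hamming-flipAt-differ i w v differ (GuardedPair.length≡ gp)) h≡d)))
                         (cong (extensions d ∘ catMaybes) (diffSteps-flipAt i false w v differ))
  ...   | false = refl

firstWalkLen-≡ : ∀ u v fuel start d → start ≤ d → d ≤ start + fuel → (∀ m → m < d → walks m u v ≡ 0) →
  0 < walks d u v → firstWalkLen u v start fuel ≡ d
firstWalkLen-≡ u v zero start d s≤d d≤s _ _ = ≤-antisym s≤d (subst (d ≤_) (+-identityʳ start) d≤s)
firstWalkLen-≡ u v (suc fuel) start d s≤d d≤s below positive with m≤n⇒m<n∨m≡n s≤d
... | inj₂ refl rewrite <ᵇ-true positive = refl
... | inj₁ s<d rewrite below start s<d =
  firstWalkLen-≡ u v fuel (suc start) d s<d (subst (d ≤_) (+-suc start fuel) d≤s) below positive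

n<2^n : ∀ n → n < 2 ^ n
n<2^n zero    = z<s
n<2^n (suc n) = ≤-trans (≤-reflexive (+-comm 1 (suc n))) (+-mono-≤ (n<2^n n) (≤-trans (m^n>0 2 n) (m≤m+n (2 ^ n) 0)))

numShortestPaths≡extensions : ∀ {w v} → GuardedPair w v → numShortestPaths w v ≡ extensions (hamming w v) (diffPattern w v)
numShortestPaths≡extensions {w} {v} gp = trans (cong (λ m → walks m w v) dist≡hamming) geodesics
  where
  geodesics : walks (hamming w v) w v ≡ extensions (hamming w v) (diffPattern w v)
  geodesics = walks-geodesic (hamming w v) gp refl
  dist≡hamming : dist w v ≡ hamming w v
  dist≡hamming = firstWalkLen-≡ w v (2 ^ length w) 0 (hamming w v) z≤n
    (≤-trans (hamming≤length w v) (<⇒≤ (n<2^n (length w))))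
    (λ m → walks-below-hamming m w v)
    (subst (0 <_) (sym geodesics)
      (extensions-positive (hamming w v) (diffPattern-startsFree w v) (length-catMaybes-diffSteps false w v)))

hamming-++ : ∀ xs ys xs′ ys′ → length xs ≡ length xs′ → hamming (xs ++ ys) (xs′ ++ ys′) ≡ hamming xs xs′ + hamming ys ys′
hamming-++ []       ys []        ys′ _ = refl
hamming-++ (x ∷ xs) ys (x′ ∷ xs′) ys′ l with x xor x′
... | true  = cong suc (hamming-++ xs ys xs′ ys′ (suc-injective l))
... | false = hamming-++ xs ys xs′ ys′ (suc-injective l)

lastDiffers : Bool → BinStr → BinStr → Bool
lastDiffers p (x ∷ xs) (y ∷ ys) = lastDiffers (x xor y) xs ys
lastDiffers p _        _        = p

diffSteps-++ : ∀ p xs ys xs′ ys′ → length xs ≡ length xs′ →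
  diffSteps p (xs ++ ys) (xs′ ++ ys′) ≡ diffSteps p xs xs′ ++ diffSteps (lastDiffers p xs xs′) ys ys′
diffSteps-++ p []       ys []        ys′ _ = refl
diffSteps-++ p (x ∷ xs) ys (x′ ∷ xs′) ys′ l = cong (_ ∷_) (diffSteps-++ (x xor x′) xs ys xs′ ys′ (suc-injective l))

guard-++ : ∀ xs xs′ {T T′} → length xs ≡ length xs′ → Guard T T′ → Guard (xs ++ T) (xs′ ++ T′)
guard-++ xs xs′ {T} {T′} l (j , pos , T-j , T′-j) =
  length xs + j , position pos , trans (bit-++ xs T j) T-j , trans (cong (λ n → bit (xs′ ++ T′) (n + j)) l) (trans (bit-++ xs′ T′ j) T′-j)
  where
  shift : ∀ d → j + d ≡ length T → length xs + j + d ≡ length (xs ++ T)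
  shift d eq = trans (+-assoc (length xs) j d) (trans (cong (length xs +_) eq) (sym (length-++ xs)))
  position : j + 3 ≡ length T ⊎ j + 1 ≡ length T → length xs + j + 3 ≡ length (xs ++ T) ⊎ length xs + j + 1 ≡ length (xs ++ T)
  position (inj₁ eq) = inj₁ (shift 3 eq)
  position (inj₂ eq) = inj₂ (shift 1 eq)

-- Swapping the last two coordinates

swapLast : BinStr → BinStr
swapLast []              = []
swapLast (a ∷ [])        = a ∷ []
swapLast (a ∷ b ∷ [])    = b ∷ a ∷ []
swapLast (a ∷ b ∷ c ∷ r) = a ∷ swapLast (b ∷ c ∷ r)

length-swapLast : ∀ x → length (swapLast x) ≡ length x
length-swapLast []              = refl
length-swapLast (_ ∷ [])        = refl
length-swapLast (_ ∷ _ ∷ [])    = refl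
length-swapLast (_ ∷ b ∷ c ∷ r) = cong suc (length-swapLast (b ∷ c ∷ r))

swapLast-∷ : ∀ a y → 2 ≤ length y → swapLast (a ∷ y) ≡ a ∷ swapLast y
swapLast-∷ a (_ ∷ _ ∷ _) _         = refl
swapLast-∷ a (_ ∷ [])    (s≤s ())

swapLast-involutive : ∀ x → swapLast (swapLast x) ≡ x
swapLast-involutive []                  = refl
swapLast-involutive (_ ∷ [])            = refl
swapLast-involutive (_ ∷ _ ∷ [])        = refl
swapLast-involutive (_ ∷ _ ∷ _ ∷ [])    = refl
swapLast-involutive (a ∷ b ∷ c ∷ d ∷ r) =
  trans (swapLast-∷ a (swapLast (b ∷ c ∷ d ∷ r)) (subst (2 ≤_) (sym (length-swapLast (b ∷ c ∷ d ∷ r))) (s≤s (s≤s z≤n))))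
        (cong (a ∷_) (swapLast-involutive (b ∷ c ∷ d ∷ r)))

swapLast-++ : ∀ xs ys → 2 ≤ length ys → swapLast (xs ++ ys) ≡ xs ++ swapLast ys
swapLast-++ []       ys 2≤ = refl
swapLast-++ (x ∷ xs) ys 2≤ =
  trans (swapLast-∷ x (xs ++ ys) (subst (2 ≤_) (sym (length-++ xs)) (≤-trans 2≤ (m≤n+m (length ys) (length xs)))))
        (cong (x ∷_) (swapLast-++ xs ys 2≤))

noConsec11-++ : ∀ xs y ys → noConsec11 (xs ++ y ∷ ys) ≡ noConsec11 (xs ++ y ∷ []) ∧ noConsec11 (y ∷ ys)
noConsec11-++ []            true  ys = refl
noConsec11-++ []            false ys = refl
noConsec11-++ (true ∷ [])   true  ys = refl
noConsec11-++ (true ∷ [])   false ys = refl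
noConsec11-++ (false ∷ [])  y     ys = noConsec11-++ [] y ys
noConsec11-++ (x ∷ x′ ∷ xs) y     ys = begin
  noConsec11 (x ∷ x′ ∷ xs ++ y ∷ ys)
    ≡⟨ noConsec11-∷∷ x x′ (xs ++ y ∷ ys) ⟩
  not (x ∧ x′) ∧ noConsec11 (x′ ∷ xs ++ y ∷ ys)
    ≡⟨ cong (not (x ∧ x′) ∧_) (noConsec11-++ (x′ ∷ xs) y ys) ⟩
  not (x ∧ x′) ∧ (noConsec11 (x′ ∷ xs ++ y ∷ []) ∧ noConsec11 (y ∷ ys))
    ≡⟨ BP.∧-assoc (not (x ∧ x′)) _ _ ⟨
  (not (x ∧ x′) ∧ noConsec11 (x′ ∷ xs ++ y ∷ [])) ∧ noConsec11 (y ∷ ys)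
    ≡⟨ cong (_∧ noConsec11 (y ∷ ys)) (noConsec11-∷∷ x x′ (xs ++ y ∷ [])) ⟨
  noConsec11 (x ∷ x′ ∷ xs ++ y ∷ []) ∧ noConsec11 (y ∷ ys) ∎
  where open ≡-Reasoning

inAltLucas-++ : ∀ ys a b c →
  inAltLucas (ys ++ a ∷ b ∷ c ∷ []) ≡ noConsec11 (ys ++ a ∷ []) ∧ (noConsec11 (a ∷ b ∷ c ∷ []) ∧ not (c ∧ a))
inAltLucas-++ ys a b c =
  trans (cong₂ _∧_ (noConsec11-++ ys a (b ∷ c ∷ [])) (lastCond-++ ys a b c)) (BP.∧-assoc (noConsec11 (ys ++ a ∷ [])) _ _)

-- The last three bits are constrained pairwise, symmetrically in the last two.
triangle-swap : ∀ a b c → noConsec11 (a ∷ b ∷ c ∷ []) ∧ not (c ∧ a) ≡ noConsec11 (a ∷ c ∷ b ∷ []) ∧ not (b ∧ a)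
triangle-swap true  true  true  = refl
triangle-swap true  true  false = refl
triangle-swap true  false true  = refl
triangle-swap true  false false = refl
triangle-swap false true  true  = refl
triangle-swap false true  false = refl
triangle-swap false false true  = refl
triangle-swap false false false = refl

inAltLucas-swapLast : ∀ {x} → EndsWith3 x → inAltLucas (swapLast x) ≡ inAltLucas x
inAltLucas-swapLast (ys ++[ a , b , c ]) = begin
  inAltLucas (swapLast (ys ++ a ∷ b ∷ c ∷ []))
    ≡⟨ cong inAltLucas (swapLast-++ ys (a ∷ b ∷ c ∷ []) (s≤s (s≤s z≤n))) ⟩
  inAltLucas (ys ++ a ∷ c ∷ b ∷ [])
    ≡⟨ inAltLucas-++ ys a c b ⟩
  noConsec11 (ys ++ a ∷ []) ∧ (noConsec11 (a ∷ c ∷ b ∷ []) ∧ not (b ∧ a))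
    ≡⟨ cong (noConsec11 (ys ++ a ∷ []) ∧_) (triangle-swap a b c) ⟨
  noConsec11 (ys ++ a ∷ []) ∧ (noConsec11 (a ∷ b ∷ c ∷ []) ∧ not (c ∧ a))
    ≡⟨ inAltLucas-++ ys a b c ⟨
  inAltLucas (ys ++ a ∷ b ∷ c ∷ []) ∎
  where open ≡-Reasoning

sumFlips : (BinStr → ℕ) → BinStr → ℕ
sumFlips G x = sum (map (λ i → G (flipAt i x)) (upTo (length x)))

sumFlips-∷ : ∀ G a x → sumFlips G (a ∷ x) ≡ G (not a ∷ x) + sumFlips (G ∘ (a ∷_)) x
sumFlips-∷ G a x = sum-upTo-suc (λ i → G (flipAt i (a ∷ x))) (length x)

sumFlips-swapLast : ∀ G x → 2 ≤ length x → sumFlips G (swapLast x) ≡ sumFlips (G ∘ swapLast) x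
sumFlips-swapLast G (_ ∷ [])        (s≤s ())
sumFlips-swapLast G (a ∷ b ∷ [])    _ = begin
  G (not b ∷ a ∷ []) + (G (b ∷ not a ∷ []) + 0) ≡⟨ cong (G (not b ∷ a ∷ []) +_) (+-identityʳ _) ⟩
  G (not b ∷ a ∷ []) + G (b ∷ not a ∷ [])       ≡⟨ +-comm (G (not b ∷ a ∷ [])) _ ⟩
  G (b ∷ not a ∷ []) + G (not b ∷ a ∷ [])       ≡⟨ cong (G (b ∷ not a ∷ []) +_) (+-identityʳ _) ⟨
  G (b ∷ not a ∷ []) + (G (not b ∷ a ∷ []) + 0) ∎
  where open ≡-Reasoning
sumFlips-swapLast G (a ∷ b ∷ c ∷ r) _ = begin
  sumFlips G (a ∷ swapLast (b ∷ c ∷ r))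
    ≡⟨ sumFlips-∷ G a (swapLast (b ∷ c ∷ r)) ⟩
  G (not a ∷ swapLast (b ∷ c ∷ r)) + sumFlips (G ∘ (a ∷_)) (swapLast (b ∷ c ∷ r))
    ≡⟨ cong (G (not a ∷ swapLast (b ∷ c ∷ r)) +_) (sumFlips-swapLast (G ∘ (a ∷_)) (b ∷ c ∷ r) (s≤s (s≤s z≤n))) ⟩
  G (not a ∷ swapLast (b ∷ c ∷ r)) + sumFlips (λ y → G (a ∷ swapLast y)) (b ∷ c ∷ r)
    ≡⟨ cong (G (not a ∷ swapLast (b ∷ c ∷ r)) +_) (cong sum (map-cong inner (upTo (length (b ∷ c ∷ r))))) ⟩
  G (not a ∷ swapLast (b ∷ c ∷ r)) + sumFlips (G ∘ swapLast ∘ (a ∷_)) (b ∷ c ∷ r)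
    ≡⟨ sumFlips-∷ (G ∘ swapLast) a (b ∷ c ∷ r) ⟨
  sumFlips (G ∘ swapLast) (a ∷ b ∷ c ∷ r) ∎
  where
  open ≡-Reasoning
  inner : ∀ i → G (a ∷ swapLast (flipAt i (b ∷ c ∷ r))) ≡ G (swapLast (a ∷ flipAt i (b ∷ c ∷ r)))
  inner i = cong G (sym (swapLast-∷ a (flipAt i (b ∷ c ∷ r))
    (subst (2 ≤_) (sym (length-flipAt i (b ∷ c ∷ r))) (s≤s (s≤s z≤n)))))

eqStr-swapLast : ∀ x y → eqStr (swapLast x) (swapLast y) ≡ eqStr x y
eqStr-swapLast x y with ≡-dec BP._≟_ (swapLast x) (swapLast y) | ≡-dec BP._≟_ x y
... | yes _  | yes _  = refl
... | no _   | no _   = refl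
... | yes eq | no ne  = contradiction (trans (sym (swapLast-involutive x)) (trans (cong swapLast eq) (swapLast-involutive y))) ne
... | no ne  | yes eq = contradiction (cong swapLast eq) ne

walks-swapLast : ∀ m x y → 3 ≤ length x → walks m (swapLast x) (swapLast y) ≡ walks m x y
walks-swapLast zero    x y _  = cong (λ b → if b then 1 else 0) (eqStr-swapLast x y)
walks-swapLast (suc m) x y 3≤ =
  trans (sumFlips-swapLast (λ z → if inAltLucas z then walks m z (swapLast y) else 0) x (≤-trans (n≤1+n 2) 3≤))
        (cong sum (map-cong neighbour (upTo (length x))))
  where
  neighbour : ∀ i → (if inAltLucas (swapLast (flipAt i x)) then walks m (swapLast (flipAt i x)) (swapLast y) else 0)
                  ≡ (if inAltLucas (flipAt i x) then walks m (flipAt i x) y else 0)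
  neighbour i = cong₂ (λ b n → if b then n else 0)
    (inAltLucas-swapLast (endsWith3 (flipAt i x) 3≤′)) (walks-swapLast m (flipAt i x) y 3≤′)
    where
    3≤′ : 3 ≤ length (flipAt i x)
    3≤′ = subst (3 ≤_) (sym (length-flipAt i x)) 3≤

firstWalkLen-cong : ∀ u v v′ → (∀ m → walks m u v ≡ walks m u v′) → ∀ fuel start →
  firstWalkLen u v start fuel ≡ firstWalkLen u v′ start fuel
firstWalkLen-cong u v v′ same zero       start = refl
firstWalkLen-cong u v v′ same (suc fuel) start rewrite same start =
  cong (if 0 <ᵇ walks start u v′ then start else_) (firstWalkLen-cong u v v′ same fuel (suc start))

numShortestPaths-cong : ∀ u v v′ → (∀ m → walks m u v ≡ walks m u v′) → numShortestPaths u v ≡ numShortestPaths u v′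
numShortestPaths-cong u v v′ same =
  trans (cong (λ d → walks d u v) (firstWalkLen-cong u v v′ same (2 ^ length u) 0)) (same (dist u v′))

numShortestPaths-swapLast : ∀ u v → 3 ≤ length u → swapLast u ≡ u → numShortestPaths u v ≡ numShortestPaths u (swapLast v)
numShortestPaths-swapLast u v 3≤ fixed = numShortestPaths-cong u v (swapLast v)
  (λ m → trans (sym (walks-swapLast m u v 3≤)) (cong (λ z → walks m z (swapLast v)) fixed))

-- The vertices of the theorem

lower upper : ℕ → ℕ → BinStr
lower s k = zeros s ++ p10 k
upper s k = ones s ++ p01 k

prefixPattern : ℕ → ℕ → List Step
prefixPattern s k = diffPattern (lower s k) (upper s k)

length-lower≡upper : ∀ s k → length (lower s k) ≡ length (upper s k)
length-lower≡upper s k = begin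
  length (zeros s ++ p10 k)          ≡⟨ length-++ (zeros s) ⟩
  length (zeros s) + length (p10 k)  ≡⟨ cong₂ _+_ (trans (length-replicate s) (sym (length-replicate s))) (p10≡p01 k) ⟩
  length (ones s) + length (p01 k)   ≡⟨ length-++ (ones s) ⟨
  length (ones s ++ p01 k)           ∎
  where
  open ≡-Reasoning
  p10≡p01 : ∀ k → length (p10 k) ≡ length (p01 k)
  p10≡p01 zero    = refl
  p10≡p01 (suc k) = cong (suc ∘ suc) (p10≡p01 k)

hamming-lower-upper : ∀ s k → hamming (lower s k) (upper s k) ≡ 2 * k + s
hamming-lower-upper s k =
  trans (hamming-++ (zeros s) (p10 k) (ones s) (p01 k) (trans (length-replicate s) (sym (length-replicate s))))
        (trans (cong₂ _+_ (zeros-ones s) (p10-p01 k)) (+-comm s (2 * k)))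
  where
  zeros-ones : ∀ s → hamming (zeros s) (ones s) ≡ s
  zeros-ones zero    = refl
  zeros-ones (suc s) = cong suc (zeros-ones s)
  p10-p01 : ∀ k → hamming (p10 k) (p01 k) ≡ 2 * k
  p10-p01 zero    = refl
  p10-p01 (suc k) = trans (cong (suc ∘ suc) (p10-p01 k)) (sym (*-suc 2 k))

lastDiffers-p10-p01 : ∀ k → lastDiffers true (p10 k) (p01 k) ≡ true
lastDiffers-p10-p01 zero    = refl
lastDiffers-p10-p01 (suc k) = lastDiffers-p10-p01 k

lastDiffers-lower-upper : ∀ s k → 1 ≤ s + k → lastDiffers false (lower s k) (upper s k) ≡ true
lastDiffers-lower-upper zero    (suc k) _ = lastDiffers-p10-p01 k
lastDiffers-lower-upper (suc s) k       _ = all-differ s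
  where
  all-differ : ∀ s → lastDiffers true (lower s k) (upper s k) ≡ true
  all-differ zero    = lastDiffers-p10-p01 k
  all-differ (suc s) = all-differ s

diffPattern-lower-upper-++ : ∀ s k T T′ → 1 ≤ s + k →
  diffPattern (lower s k ++ T) (upper s k ++ T′) ≡ prefixPattern s k ++ catMaybes (diffSteps true T T′)
diffPattern-lower-upper-++ s k T T′ 1≤ = begin
  catMaybes (diffSteps false (lower s k ++ T) (upper s k ++ T′))
    ≡⟨ cong catMaybes (diffSteps-++ false (lower s k) T (upper s k) T′ (length-lower≡upper s k)) ⟩
  catMaybes (diffSteps false (lower s k) (upper s k) ++ diffSteps (lastDiffers false (lower s k) (upper s k)) T T′)
    ≡⟨ catMaybes-++ (diffSteps false (lower s k) (upper s k)) _ ⟩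
  prefixPattern s k ++ catMaybes (diffSteps (lastDiffers false (lower s k) (upper s k)) T T′)
    ≡⟨ cong (λ p → prefixPattern s k ++ catMaybes (diffSteps p T T′)) (lastDiffers-lower-upper s k 1≤) ⟩
  prefixPattern s k ++ catMaybes (diffSteps true T T′) ∎
  where open ≡-Reasoning

prefixPattern-suc : ∀ s k → 1 ≤ s + k → prefixPattern s (suc k) ≡ prefixPattern s k ++ down ∷ up ∷ []
prefixPattern-suc s k 1≤ = trans
  (cong₂ diffPattern (extend (zeros s) (p10 k) true false (p10-∷ʳ k)) (extend (ones s) (p01 k) false true (p01-∷ʳ k)))
  (diffPattern-lower-upper-++ s k (true ∷ false ∷ []) (false ∷ true ∷ []) 1≤)
  where
  extend : ∀ xs ys a b {zs} → ys ++ a ∷ b ∷ [] ≡ zs → xs ++ zs ≡ (xs ++ ys) ++ a ∷ b ∷ []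
  extend xs ys a b eq = trans (cong (xs ++_) (sym eq)) (sym (++-assoc xs ys (a ∷ b ∷ [])))
  p10-∷ʳ : ∀ k → p10 k ++ true ∷ false ∷ [] ≡ p10 (suc k)
  p10-∷ʳ zero    = refl
  p10-∷ʳ (suc k) = cong (λ xs → true ∷ false ∷ xs) (p10-∷ʳ k)
  p01-∷ʳ : ∀ k → p01 k ++ false ∷ true ∷ [] ≡ p01 (suc k)
  p01-∷ʳ zero    = refl
  p01-∷ʳ (suc k) = cong (λ xs → false ∷ true ∷ xs) (p01-∷ʳ k)

diffSteps-p10-p01 : ∀ k → catMaybes (diffSteps true (p10 k) (p01 k)) ≡ zigzag down (2 * k)
diffSteps-p10-p01 zero    = refl
diffSteps-p10-p01 (suc k) = trans (cong (λ p → down ∷ up ∷ p) (diffSteps-p10-p01 k))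
                                  (sym (cong (λ n → down ∷ zigzag up n) (+-suc k (k + 0))))

-- prefixPattern s k is free ∷ down ∷ up ∷ ⋯ for s = 1 and free ∷ up ∷ down ∷ ⋯ for s = 0; the latter has
-- even length, so it is an alternating pattern read backwards.
extensions-prefixPattern : ∀ s k → s ≤ 1 → extensions (2 * k + s) (prefixPattern s k) ≡ Euler (2 * k + s)
extensions-prefixPattern zero zero _ = refl
extensions-prefixPattern zero (suc j) _ = begin
  extensions (2 * suc j + 0) (free ∷ up ∷ catMaybes (diffSteps true (p10 j) (p01 j)))
    ≡⟨ cong₂ extensions (trans (+-identityʳ (2 * suc j)) (*-suc 2 j)) (cong (λ p → free ∷ up ∷ p) (diffSteps-p10-p01 j)) ⟩
  extensions (suc (suc (2 * j))) (free ∷ zigzag up (suc (2 * j)))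
    ≡⟨ Euler≡extensions-up j ⟨
  Euler (suc (suc (2 * j)))
    ≡⟨ cong Euler (trans (+-identityʳ (2 * suc j)) (*-suc 2 j)) ⟨
  Euler (2 * suc j + 0) ∎
  where open ≡-Reasoning
extensions-prefixPattern (suc zero) k _ = begin
  extensions (2 * k + 1) (free ∷ catMaybes (diffSteps true (p10 k) (p01 k)))
    ≡⟨ cong₂ extensions (+-comm (2 * k) 1) (cong (free ∷_) (diffSteps-p10-p01 k)) ⟩
  extensions (suc (2 * k)) (alternating (suc (2 * k)))
    ≡⟨ Euler≡extensions (suc (2 * k)) ⟨
  Euler (suc (2 * k))
    ≡⟨ cong Euler (+-comm (2 * k) 1) ⟨
  Euler (2 * k + 1) ∎
  where open ≡-Reasoning
extensions-prefixPattern (suc (suc _)) _ (s≤s ())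

noConsec11-lower : ∀ s k r → noConsec11 (lower s k ++ r) ≡ noConsec11 r
noConsec11-lower s k r = trans (cong noConsec11 (++-assoc (zeros s) (p10 k) r)) (trans (zeros-++ s) (p10-++ k))
  where
  zeros-++ : ∀ s → noConsec11 (zeros s ++ p10 k ++ r) ≡ noConsec11 (p10 k ++ r)
  zeros-++ zero    = refl
  zeros-++ (suc s) = zeros-++ s
  p10-++ : ∀ k → noConsec11 (p10 k ++ r) ≡ noConsec11 r
  p10-++ zero    = refl
  p10-++ (suc k) = p10-++ k

noConsec11-upper : ∀ s k r → s ≤ 1 → noConsec11 (upper s k ++ false ∷ r) ≡ noConsec11 (false ∷ r)
noConsec11-upper s k r s≤1 = trans (cong noConsec11 (++-assoc (ones s) (p01 k) (false ∷ r))) (ones-++ s k s≤1)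
  where
  true-p01-++ : ∀ k → noConsec11 (true ∷ p01 k ++ false ∷ r) ≡ noConsec11 (false ∷ r)
  true-p01-++ zero    = refl
  true-p01-++ (suc k) = true-p01-++ k
  ones-++ : ∀ s k → s ≤ 1 → noConsec11 (ones s ++ p01 k ++ false ∷ r) ≡ noConsec11 (false ∷ r)
  ones-++ zero       zero    _ = refl
  ones-++ zero       (suc k) _ = true-p01-++ k
  ones-++ (suc zero) k       _ = true-p01-++ k
  ones-++ (suc (suc _)) _    (s≤s ())

-- The last three coordinates of the vertex pairs of the theorem, except 100/001, which swapLast turns into
-- 100/010.
data Endings : BinStr → BinStr → Set where
  100→010 : Endings b100 b010
  001→010 : Endings b001 b010
  010→001 : Endings b010 b001

endings-guard : ∀ {T T′} → Endings T T′ → Guard T T′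
endings-guard 100→010 = 2 , inj₂ refl , refl , refl
endings-guard 001→010 = 0 , inj₁ refl , refl , refl
endings-guard 010→001 = 0 , inj₁ refl , refl , refl

endings-hamming : ∀ {T T′} → Endings T T′ → hamming T T′ ≡ 2
endings-hamming 100→010 = refl
endings-hamming 001→010 = refl
endings-hamming 010→001 = refl

endings-length : ∀ {T T′} → Endings T T′ → length T ≡ length T′
endings-length 100→010 = refl
endings-length 001→010 = refl
endings-length 010→001 = refl

inAltLucas-prefix : ∀ ys a b c → noConsec11 (ys ++ a ∷ b ∷ c ∷ []) ≡ noConsec11 (a ∷ b ∷ c ∷ []) →
  inAltLucas (ys ++ a ∷ b ∷ c ∷ []) ≡ inAltLucas (a ∷ b ∷ c ∷ [])
inAltLucas-prefix ys a b c eq = cong₂ _∧_ eq (lastCond-++ ys a b c)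

endings-∈ : ∀ {T T′} → Endings T T′ → ∀ ys ys′ → (∀ r → noConsec11 (ys ++ r) ≡ noConsec11 r) →
  (∀ r → noConsec11 (ys′ ++ false ∷ r) ≡ noConsec11 (false ∷ r)) →
  inAltLucas (ys ++ T) ≡ true × inAltLucas (ys′ ++ T′) ≡ true
endings-∈ 100→010 ys ys′ open-end closed-end =
  inAltLucas-prefix ys true false false (open-end _) , inAltLucas-prefix ys′ false true false (closed-end _)
endings-∈ 001→010 ys ys′ open-end closed-end =
  inAltLucas-prefix ys false false true (open-end _) , inAltLucas-prefix ys′ false true false (closed-end _)
endings-∈ 010→001 ys ys′ open-end closed-end =
  inAltLucas-prefix ys false true false (open-end _) , inAltLucas-prefix ys′ false false true (closed-end _)

guardedPair-lower-upper : ∀ s k {T T′} → s ≤ 1 → Endings T T′ → GuardedPair (lower s k ++ T) (upper s k ++ T′)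
guardedPair-lower-upper s k {T} {T′} s≤1 e = record
  { w∈      = proj₁ members
  ; v∈      = proj₂ members
  ; length≡ = trans (length-++ (lower s k)) (trans (cong₂ _+_ (length-lower≡upper s k) (endings-length e))
                                                   (sym (length-++ (upper s k))))
  ; guard   = guard-++ (lower s k) (upper s k) (length-lower≡upper s k) (endings-guard e)
  }
  where
  members : inAltLucas (lower s k ++ T) ≡ true × inAltLucas (upper s k ++ T′) ≡ true
  members = endings-∈ e (lower s k) (upper s k) (noConsec11-lower s k) (λ r → noConsec11-upper s k r s≤1)

numShortestPaths-lower-upper : ∀ s k {T T′} → s ≤ 1 → 1 ≤ s + k → Endings T T′ →
  numShortestPaths (zeros s ++ p10 k ++ T) (ones s ++ p01 k ++ T′)
    ≡ extensions (2 * k + s + 2) (prefixPattern s k ++ catMaybes (diffSteps true T T′))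
numShortestPaths-lower-upper s k {T} {T′} s≤1 1≤ e = begin
  numShortestPaths (zeros s ++ p10 k ++ T) (ones s ++ p01 k ++ T′)
    ≡⟨ cong₂ numShortestPaths (++-assoc (zeros s) (p10 k) T) (++-assoc (ones s) (p01 k) T′) ⟨
  numShortestPaths (lower s k ++ T) (upper s k ++ T′)
    ≡⟨ numShortestPaths≡extensions (guardedPair-lower-upper s k s≤1 e) ⟩
  extensions (hamming (lower s k ++ T) (upper s k ++ T′)) (diffPattern (lower s k ++ T) (upper s k ++ T′))
    ≡⟨ cong₂ extensions hamming≡ (diffPattern-lower-upper-++ s k T T′ 1≤) ⟩
  extensions (2 * k + s + 2) (prefixPattern s k ++ catMaybes (diffSteps true T T′)) ∎
  where
  open ≡-Reasoning
  hamming≡ : hamming (lower s k ++ T) (upper s k ++ T′) ≡ 2 * k + s + 2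
  hamming≡ = trans (hamming-++ (lower s k) T (upper s k) T′ (length-lower≡upper s k))
                   (cong₂ _+_ (hamming-lower-upper s k) (endings-hamming e))

swapLast-vertex : ∀ xs ys a b c → swapLast (xs ++ ys ++ a ∷ b ∷ c ∷ []) ≡ xs ++ ys ++ a ∷ c ∷ b ∷ []
swapLast-vertex xs ys a b c =
  trans (swapLast-++ xs (ys ++ a ∷ b ∷ c ∷ []) (≤-trans (n≤1+n 2) (length-++-≤ʳ (a ∷ b ∷ c ∷ []) {ys})))
        (cong (xs ++_) (swapLast-++ ys (a ∷ b ∷ c ∷ []) (s≤s (s≤s z≤n))))

extensions-prefixPattern-++ : ∀ s k r → s ≤ 1 →
  extensions (2 * k + s + 2) (prefixPattern s k ++ free ∷ r ∷ [])
    ≡ ((2 * k + s + 2) C 2) * (Euler (2 * k + s) * extensions 2 (free ∷ r ∷ []))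
extensions-prefixPattern-++ s k r s≤1 =
  trans (extensions-++ (2 * k + s + 2) (trans (length-catMaybes-diffSteps false (lower s k) (upper s k)) (hamming-lower-upper s k))
                       refl refl (free∷ (r ∷ [])))
        (cong (λ e → ((2 * k + s + 2) C 2) * (e * extensions 2 (free ∷ r ∷ []))) (extensions-prefixPattern s k s≤1))

numShortestPaths-100-010 : ∀ s k → s ≤ 1 → 1 ≤ s + k →
  numShortestPaths (zeros s ++ p10 k ++ b100) (ones s ++ p01 k ++ b010) ≡ Euler (2 * k + s + 2)
numShortestPaths-100-010 s k s≤1 1≤ = begin
  numShortestPaths (zeros s ++ p10 k ++ b100) (ones s ++ p01 k ++ b010)
    ≡⟨ numShortestPaths-lower-upper s k s≤1 1≤ 100→010 ⟩
  extensions (2 * k + s + 2) (prefixPattern s k ++ down ∷ up ∷ [])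
    ≡⟨ cong₂ extensions (2[1+k]+s≡ k s) (prefixPattern-suc s k 1≤) ⟨
  extensions (2 * suc k + s) (prefixPattern s (suc k))
    ≡⟨ extensions-prefixPattern s (suc k) s≤1 ⟩
  Euler (2 * suc k + s)
    ≡⟨ cong Euler (2[1+k]+s≡ k s) ⟩
  Euler (2 * k + s + 2) ∎
  where
  open ≡-Reasoning
  2[1+k]+s≡ : ∀ k s → 2 * suc k + s ≡ 2 * k + s + 2
  2[1+k]+s≡ = solve-∀

numShortestPaths-100-001 : ∀ s k → numShortestPaths (zeros s ++ p10 k ++ b100) (ones s ++ p01 k ++ b001)
                                  ≡ numShortestPaths (zeros s ++ p10 k ++ b100) (ones s ++ p01 k ++ b010)
numShortestPaths-100-001 s k = begin
  numShortestPaths u (ones s ++ p01 k ++ b001)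
    ≡⟨ numShortestPaths-swapLast u _ (≤-trans (length-++-≤ʳ b100 {p10 k}) (length-++-≤ʳ (p10 k ++ b100) {zeros s}))
         (swapLast-vertex (zeros s) (p10 k) true false false) ⟩
  numShortestPaths u (swapLast (ones s ++ p01 k ++ b001))
    ≡⟨ cong (numShortestPaths u) (swapLast-vertex (ones s) (p01 k) false false true) ⟩
  numShortestPaths u (ones s ++ p01 k ++ b010) ∎
  where
  open ≡-Reasoning
  u : BinStr
  u = zeros s ++ p10 k ++ b100

numShortestPaths-free-tail : ∀ s k {T T′} → s ≤ 1 → 1 ≤ s + k → Endings T T′ → ∀ r →
  catMaybes (diffSteps true T T′) ≡ free ∷ r ∷ [] → extensions 2 (free ∷ r ∷ []) ≡ 1 →
  numShortestPaths (zeros s ++ p10 k ++ T) (ones s ++ p01 k ++ T′) ≡ ((2 * k + s + 2) C 2) * Euler (2 * k + s)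
numShortestPaths-free-tail s k {T} {T′} s≤1 1≤ e r tail≡ single = begin
  numShortestPaths (zeros s ++ p10 k ++ T) (ones s ++ p01 k ++ T′)
    ≡⟨ numShortestPaths-lower-upper s k s≤1 1≤ e ⟩
  extensions (2 * k + s + 2) (prefixPattern s k ++ catMaybes (diffSteps true T T′))
    ≡⟨ cong (λ q → extensions (2 * k + s + 2) (prefixPattern s k ++ q)) tail≡ ⟩
  extensions (2 * k + s + 2) (prefixPattern s k ++ free ∷ r ∷ [])
    ≡⟨ extensions-prefixPattern-++ s k r s≤1 ⟩
  ((2 * k + s + 2) C 2) * (Euler (2 * k + s) * extensions 2 (free ∷ r ∷ []))
    ≡⟨ cong (λ e → ((2 * k + s + 2) C 2) * (Euler (2 * k + s) * e)) single ⟩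
  ((2 * k + s + 2) C 2) * (Euler (2 * k + s) * 1)
    ≡⟨ cong (((2 * k + s + 2) C 2) *_) (*-identityʳ (Euler (2 * k + s))) ⟩
  ((2 * k + s + 2) C 2) * Euler (2 * k + s) ∎
  where open ≡-Reasoning

n∸1≡ : ∀ k s → 2 * k + 3 + s ∸ 1 ≡ 2 * k + s + 2
n∸1≡ k s = trans (cong (_∸ 1) (shape k s)) (m+n∸n≡m (2 * k + s + 2) 1)
  where
  shape : ∀ k s → 2 * k + 3 + s ≡ 2 * k + s + 2 + 1
  shape = solve-∀

n∸3≡ : ∀ k s → 2 * k + 3 + s ∸ 3 ≡ 2 * k + s
n∸3≡ k s = trans (cong (_∸ 3) (shape k s)) (m+n∸n≡m (2 * k + s) 3)
  where
  shape : ∀ k s → 2 * k + 3 + s ≡ 2 * k + s + 3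
  shape = solve-∀

prefix-nonEmpty : ∀ k s → 4 ≤ 2 * k + 3 + s → 1 ≤ s + k
prefix-nonEmpty k       (suc s) _ = s≤s z≤n
prefix-nonEmpty (suc k) zero    _ = s≤s z≤n
prefix-nonEmpty zero    zero    (s≤s (s≤s (s≤s ())))

theorem3 : (k s : ℕ) → s ≤ 1 → 4 ≤ 2 * k + 3 + s →
    (numShortestPaths (zeros s ++ p10 k ++ b100) (ones s ++ p01 k ++ b001) ≡ Euler (2 * k + 3 + s ∸ 1))
    × (numShortestPaths (zeros s ++ p10 k ++ b100) (ones s ++ p01 k ++ b010) ≡ Euler (2 * k + 3 + s ∸ 1))
    × (numShortestPaths (zeros s ++ p10 k ++ b001) (ones s ++ p01 k ++ b010) ≡ ((2 * k + 3 + s ∸ 1) C 2) * Euler (2 * k + 3 + s ∸ 3))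
    × (numShortestPaths (zeros s ++ p10 k ++ b010) (ones s ++ p01 k ++ b001) ≡ ((2 * k + 3 + s ∸ 1) C 2) * Euler (2 * k + 3 + s ∸ 3))
theorem3 k s s≤1 4≤n rewrite n∸1≡ k s | n∸3≡ k s =
    trans (numShortestPaths-100-001 s k) down-up
  , down-up
  , numShortestPaths-free-tail s k s≤1 1≤s+k 001→010 down refl refl
  , numShortestPaths-free-tail s k s≤1 1≤s+k 010→001 up refl refl
  where
  1≤s+k : 1 ≤ s + k
  1≤s+k = prefix-nonEmpty k s 4≤n
  down-up : numShortestPaths (zeros s ++ p10 k ++ b100) (ones s ++ p01 k ++ b010) ≡ Euler (2 * k + s + 2)
  down-up = numShortestPaths-100-010 s k s≤1 1≤s+k
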